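{- Let $\mathcal{P}=(\mathcal{PV},\mathcal{L},\ell_0,\mathcal{T})$ be an integer program and $\mathcal{PV}'=\{x_1,\ldots,x_d\}\subseteq\mathcal{PV}$. Let $t=(\ell,\varphi,\eta,\ell)\in\mathcal{T}$ with $\varphi\in\mathcal{F}(\mathcal{PV}')$, $\eta(v)\in\mathbb{Z}[\mathcal{PV}']$ for all $v\in\mathcal{PV}'$, and $\eta(v)=v$ for all $v\in\mathcal{PV}\setminus\mathcal{PV}'$. For each entry transition $r\in\mathcal{E}_{\{t\}}$ let $\psi_r\in\mathcal{F}(\mathcal{PV}')$ be such that $\models\psi_r\to\eta(\psi_r)$ and $\sigma(\psi_r)$ holds whenever there is a state $\sigma_0$ with $(\ell_0,\sigma_0)\to^*_{\mathcal{T}}\circ\to_r(\ell,\sigma)$, and let $L_r=(\psi_r,\varphi,\eta|_{\mathcal{PV}'})$. Define ${\mathcal{RB}_{\text{loc}}}(r)={\operatorname{sth}^{\sqcup}}$ if $L_r$ is a terminating tnn-loop, where ${\operatorname{sth}^{\sqcup}}$ is a stabilization bound polynomial of $L_r$; ${\mathcal{RB}_{\text{loc}}}(r)=2\cdot{\operatorname{sth}^{\sqcup}}+1$ if $L_r$ is a terminating twn-loop but not a tnn-loop, where ${\operatorname{sth}^{\sqcup}}$ is a stabilization bound polynomial of $L_r\star L_r$; and ${\mathcal{RB}_{\text{loc}}}(r)=\omega$ otherwise. Then ${\mathcal{RB}_{\text{loc}}}:\mathcal{E}_{\{t\}}\to\mathcal{B}$ is a local runtime bound for $\{t\}=\mathcal{T}'_>=\mathcal{T}'$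 in $\mathcal{P}$.
   Context: Integer programs: $\mathcal{F}(\mathcal{V})$ are propositional formulas ($\land,\lor$) over atoms $q_1<q_2$, $q_i\in\mathbb{Z}[\mathcal{V}]$. An integer program $(\mathcal{PV},\mathcal{L},\ell_0,\mathcal{T})$ has a finite set $\mathcal{PV}\subseteq\mathcal{V}$ of program variables, finite locations $\mathcal{L}$ with initial $\ell_0$, and finite transitions $(\ell,\varphi,\eta,\ell')$ with $\ell'\neq\ell_0$, guard $\varphi\in\mathcal{F}(\mathcal{V})$, update $\eta:\mathcal{PV}\to\mathbb{Z}[\mathcal{V}]$. States are $\sigma:\mathcal{V}\to\mathbb{Z}$; $|\sigma|(v)=|\sigma(v)|$; $(\ell,\sigma)\to_s(\ell',\sigma')$ for $s=(\ell,\varphi,\eta,\ell')$ iff $\sigma(\varphi)$ holds and $\sigma'(v)=\sigma(\eta(v))$ for $v\in\mathcal{PV}$; $\to_{\mathcal{T}}$ is the union over $\mathcal{T}$, $\to^*$ its reflexive-transitive closure. Bounds $\mathcal{B}$: smallest set containing $\mathbb{N}\cup\{\omega\}$ and $\mathcal{PV}$, closed under $+$, $\cdot$, $k^{b}$ ($k\in\mathbb{N}$). $\mathcal{E}_{\mathcal{T}'}$: transitions in $\mathcal{T}\setminus\mathcal{T}'$ whose target is the start location of a transition of $\mathcal{T}'$. A local runtime bound for $\mathcal{T}'_>$ w.r.t. $\mathcal{T}'$ is ${\mathcal{RB}_{\text{loc}}}:\mathcal{E}_{\mathcal{T}'}\to\mathcal{B}$ with $|\sigma|({\mathcal{RB}_{\text{loc}}}(r))\ge\sup\{k\mid\exists\sigma_0,\ell'',(\ell',\sigma').\,(\ell_0,\sigma_0)\to^*_{\mathcal{T}}\circ\to_r(\ell'',\sigma)(\to^*_{\mathcal{T}'}\circ\to_s)^k(\ell',\sigma')\}$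 for all $s\in\mathcal{T}'_>$, $r\in\mathcal{E}_{\mathcal{T}'}$, states $\sigma$. Twn-loops: $(\psi,\varphi,\eta)$ over $\{x_1,\ldots,x_d\}$ is the program with transitions $(\ell_0,\psi,\mathrm{id},\ell)$ and $(\ell,\varphi,\eta,\ell)$, with $\models\psi\to\eta(\psi)$ and $\eta(x_i)=c_ix_i+p_i$, $c_i\in\mathbb{Z}$, $p_i\in\mathbb{Z}[x_{i+1},\ldots,x_d]$; tnn-loop if all $c_i\ge0$; terminating if it has no infinite evaluation. $L\star L$ for $L=(\psi,\varphi,\eta)$ is $(\psi,\varphi\land\eta(\varphi),\eta\circ\eta)$. Stabilization bound polynomial of a terminating tnn-loop $L=(\psi,\varphi,\eta)$: let $\psi'=\psi\land\varphi$, $\Psi'=\{\vec e\in\mathbb{Z}^d\mid\sigma_{\vec e}(\psi')\}$ with $\sigma_{\vec e}(x_i)=e_i$. Take a normalized closed form $\overline{\vec x}$ of $\eta$ with start value $n_0$ (expressions over $\vec x$ and $n$ with $\sigma(\overline{x_i})=\sigma(\eta^n(x_i))$ whenever $\sigma(n)\ge n_0$) whose components are of the form $\sum_j p_j n^{a_j}b_j^n$, $p_j\in\mathbb{Q}[\vec x]$, $a_j\in\mathbb{N}$, $b_j\in\mathbb{N}_{\ge1}$. For each atom $\alpha=(s_1<s_2)$ of $\varphi$, $npe_\alpha$ is $(s_2-s_1)[\vec x/\overline{\vec x}]$ multiplied by the lcm of its denominators, written as $\sum_{(p,a,b)\in\Lambda}p\,n^ab^n$ with monomials $p$. Choose disjoint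 $\Delta,\Gamma\subseteq\Lambda$ with $\models\psi'\to p>0$ on $\Delta$, $\models\psi'\to p\le0$ on $\Gamma$, and $i_{(p,a,b)},j_{(p,a,b)}\in\mathbb{N}$ with $(j,i)>_{\mathrm{lex}}(b,a)$ on $\Delta$, $(b,a)>_{\mathrm{lex}}(j,i)$ on $\Gamma$ ($>_{\mathrm{lex}}$ lexicographic on pairs); set $\overline{npe_\alpha}=\sum_{\Delta\cup\Gamma}p\,n^{i}j^n+\sum_{\Lambda\setminus(\Delta\cup\Gamma)}p\,n^ab^n$, required to be eventually non-positive (if $\overline{npe_\alpha}\ne npe_\alpha$, then for each $\vec e\in\Psi'$, $\sigma_{\vec e}(\overline{npe_\alpha})\le0$ for all large $n$). The $k$-monotonicity threshold of $(b_1,a_1)>_{\mathrm{lex}}(b_2,a_2)$ is the least $n_0$ with $n^{a_1}b_1^n>k\,n^{a_2}b_2^n$ for all $n\ge n_0$. $D_\alpha$ is the max ($\max\emptyset=0$) of the 1-monotonicity thresholds of $(j,i),(b,a)$ over $\Delta$ and $(b,a),(j,i)$ over $\Gamma$. Write $\overline{npe_\alpha}=\sum_{j=1}^{\ell}p_jn^{a_j}b_j^n$ with $p_j\ne0$, $(b_\ell,a_\ell)>_{\mathrm{lex}}\cdots>_{\mathrm{lex}}(b_1,a_1)$; $C_\alpha=\max\{1,N_2,M_2,\ldots,N_\ell,M_\ell\}$ with $M_j=0$ if $b_j=b_{j-1}$, else the 1-monotonicity threshold of $(b_j,a_j)$ and $(b_{j-1},a_{j-1}+1)$; $N_2=1$,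 $N_3=mt'$, $N_j=\max\{mt,mt'\}$ ($j>3$), $mt'$ the $(j-2)$-monotonicity threshold of $(b_{j-1},a_{j-1})$ and $(b_{j-2},a_{j-2})$, $mt$ the max of the 1-monotonicity thresholds of $(b_{j-2},a_{j-2})$ and $(b_i,a_i)$, $1\le i\le j-3$. With $Pol=\bigcup_\alpha\{p_1,\ldots,p_{\ell-1}\}$, $C=\max_\alpha C_\alpha$, $D=\max_\alpha D_\alpha$, the polynomial is $2\cdot\sqcup Pol+\max\{n_0,C,D\}$, where $\sqcup\{q_1,\ldots,q_m\}=\sum_{\vec e}c_{\vec e}\vec x^{\vec e}$ with $c_{\vec e}$ the maximal absolute coefficient of monomial $\vec x^{\vec e}$ among the $q_k$ ($0$ if none). -}

module Defs where

open import Data.Bool using (Bool; true; false; if_then_else_; not; _∨_; _∧_)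
open import Data.Nat as ℕ using (ℕ; zero; suc; _∸_; _<ᵇ_; _≡ᵇ_)
open import Data.Nat.LCM using (lcm)
open import Data.Integer as ℤ using (ℤ; +_; ∣_∣)
open import Data.Rational as ℚ using (ℚ; ↥_; ↧ₙ_; 0ℚ)
import Data.Rational.Properties as ℚP
open import Data.Fin using (Fin; toℕ)
open import Data.Vec as Vec using (Vec; []; _∷_)
import Data.Vec.Properties as VecP
open import Data.List as List using (List; []; _∷_; [_]; _++_; length; foldr; filterᵇ; tabulate; concatMap; upTo; map)
open import Data.List.Membership.Propositional using (_∈_; _∉_)
open import Data.List.Membership.DecPropositional ℕ._≟_ using (_∈?_)
open import Data.List.Relation.Unary.All using (All)
open import Data.List.Relation.Unary.Any using (Any)
open import Data.Product using (Σ; ∃; _×_; _,_; proj₁; proj₂)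
import Data.Product.Properties as ProdP
open import Data.Sum using (_⊎_)
open import Data.Unit using (⊤)
open import Relation.Nullary using (¬_; does)
open import Relation.Binary.PropositionalEquality using (_≡_)
open import Relation.Binary.Definitions using (DecidableEquality)
open import Relation.Binary.Construct.Closure.ReflexiveTransitive using (Star)

Var : Set
Var = ℕ

State : Set
State = Var → ℤ

data Poly : Set where
  var  : Var → Poly
  con  : ℤ → Poly
  _⊕_  : Poly → Poly → Poly
  _⊗_  : Poly → Poly → Poly
  ⊝_   : Poly → Poly

⟦_⟧ : Poly → State → ℤ
⟦ var v ⟧ σ = σ v
⟦ con z ⟧ σ = z
⟦ p ⊕ q ⟧ σ = ⟦ p ⟧ σ ℤ.+ ⟦ q ⟧ σ
⟦ p ⊗ q ⟧ σ = ⟦ p ⟧ σ ℤ.* ⟦ q ⟧ σ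
⟦ ⊝ p ⟧ σ = ℤ.- ⟦ p ⟧ σ

data Formula : Set where
  _≺_ : Poly → Poly → Formula
  _⋀_ : Formula → Formula → Formula
  _⋁_ : Formula → Formula → Formula

⟦_⟧F : Formula → State → Set
⟦ p ≺ q ⟧F σ = ⟦ p ⟧ σ ℤ.< ⟦ q ⟧ σ
⟦ φ ⋀ ψ ⟧F σ = ⟦ φ ⟧F σ × ⟦ ψ ⟧F σ
⟦ φ ⋁ ψ ⟧F σ = ⟦ φ ⟧F σ ⊎ ⟦ ψ ⟧F σ

atoms : Formula → List (Poly × Poly)
atoms (p ≺ q) = [ (p , q) ]
atoms (φ ⋀ ψ) = atoms φ ++ atoms ψ
atoms (φ ⋁ ψ) = atoms φ ++ atoms ψ

PolyOver : List Var → Poly → Set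
PolyOver S (var v) = v ∈ S
PolyOver S (con z) = ⊤
PolyOver S (p ⊕ q) = PolyOver S p × PolyOver S q
PolyOver S (p ⊗ q) = PolyOver S p × PolyOver S q
PolyOver S (⊝ p) = PolyOver S p

FormulaOver : List Var → Formula → Set
FormulaOver S (p ≺ q) = PolyOver S p × PolyOver S q
FormulaOver S (φ ⋀ ψ) = FormulaOver S φ × FormulaOver S ψ
FormulaOver S (φ ⋁ ψ) = FormulaOver S φ × FormulaOver S ψ

substP : List Var → (Var → Poly) → Poly → Poly
substP PV η (var v) = if does (v ∈? PV) then η v else var v
substP PV η (con z) = con z
substP PV η (p ⊕ q) = substP PV η p ⊕ substP PV η q
substP PV η (p ⊗ q) = substP PV η p ⊗ substP PV η q
substP PV η (⊝ p) = ⊝ substP PV η p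

substF : List Var → (Var → Poly) → Formula → Formula
substF PV η (p ≺ q) = substP PV η p ≺ substP PV η q
substF PV η (φ ⋀ ψ) = substF PV η φ ⋀ substF PV η ψ
substF PV η (φ ⋁ ψ) = substF PV η φ ⋁ substF PV η ψ

iterP : List Var → (Var → Poly) → ℕ → Poly → Poly
iterP PV η zero p = p
iterP PV η (suc n) p = substP PV η (iterP PV η n p)

record Trans : Set where
  constructor trans
  field
    src    : ℕ
    guard  : Formula
    upd    : Var → Poly     -- only its values on PV matter
    tgt    : ℕ
open Trans public

-- transitions are indexed by Fin nT (distinct indices = distinct transitions)
record Program : Set where
  constructor program
  field
    PV  : List Var
    nT  : ℕ
    T   : Fin nT → Trans
    ℓ₀  : ℕ
open Program public

WellFormed : Program → Set
WellFormed P = ∀ i → ¬ (tgt (T P i) ≡ ℓ₀ P)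

Config : Set
Config = ℕ × State

Rel : Set₁
Rel = Config → Config → Set

Step : (P : Program) → Trans → Rel
Step P τ (ℓ , σ) (ℓ' , σ') =
  ℓ ≡ src τ × ℓ' ≡ tgt τ × ⟦ guard τ ⟧F σ × (∀ v → v ∈ PV P → σ' v ≡ ⟦ upd τ v ⟧ σ)

StepIn : (P : Program) → (Fin (nT P) → Set) → Rel
StepIn P S c c' = Σ (Fin (nT P)) λ i → S i × Step P (T P i) c c'

StepAll : (P : Program) → Rel
StepAll P = StepIn P (λ _ → ⊤)

_⨾_ : Rel → Rel → Rel
(R ⨾ Q) c c'' = Σ Config λ c' → R c c' × Q c' c''

Pow : ℕ → Rel → Rel
Pow zero R = _≡_
Pow (suc k) R = R ⨾ Pow k R

Entry : (P : Program) → (Fin (nT P) → Set) → Fin (nT P) → Set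
Entry P T' r = ¬ T' r × Σ (Fin (nT P)) λ s → T' s × tgt (T P r) ≡ src (T P s)

data ℕ∞ : Set where
  fin : ℕ → ℕ∞
  ∞   : ℕ∞

_+∞_ : ℕ∞ → ℕ∞ → ℕ∞
fin m +∞ fin n = fin (m ℕ.+ n)
_ +∞ _ = ∞

_*∞_ : ℕ∞ → ℕ∞ → ℕ∞
fin m *∞ fin n = fin (m ℕ.* n)
fin zero *∞ ∞ = fin 0
∞ *∞ fin zero = fin 0
_ *∞ _ = ∞

pow∞ : ℕ → ℕ∞ → ℕ∞
pow∞ k (fin n) = fin (k ℕ.^ n)
pow∞ zero ∞ = fin 0
pow∞ (suc zero) ∞ = fin 1
pow∞ (suc (suc _)) ∞ = ∞

data _≤∞_ : ℕ∞ → ℕ∞ → Set where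
  fin≤ : ∀ {m n} → m ℕ.≤ n → fin m ≤∞ fin n
  _≤ω  : ∀ x → x ≤∞ ∞

data Bound : Set where
  nat  : ℕ → Bound
  ω    : Bound
  bvar : Var → Bound
  _⊞_  : Bound → Bound → Bound
  _⊠_  : Bound → Bound → Bound
  _^^_ : ℕ → Bound → Bound

evalB : (Var → ℕ) → Bound → ℕ∞
evalB ρ (nat n) = fin n
evalB ρ ω = ∞
evalB ρ (bvar v) = fin (ρ v)
evalB ρ (b ⊞ c) = evalB ρ b +∞ evalB ρ c
evalB ρ (b ⊠ c) = evalB ρ b *∞ evalB ρ c
evalB ρ (k ^^ b) = pow∞ k (evalB ρ b)

∣_∣ₛ : State → (Var → ℕ)
∣ σ ∣ₛ v = ∣ σ v ∣

-- RB_loc is a local runtime bound for T'> w.r.t. T'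
-- (RB is given on all transition indices; only its values on 𝓔_{T'} matter)
LocalRuntimeBound : (P : Program) → (T'> T' : Fin (nT P) → Set) → (Fin (nT P) → Bound) → Set
LocalRuntimeBound P T'> T' RB =
  ∀ s → T'> s → ∀ r → Entry P T' r →
  ∀ (σ₀ : State) (c : Config) (ℓ'' : ℕ) (σ : State) (k : ℕ) (c' : Config) →
  Star (StepAll P) (ℓ₀ P , σ₀) c →
  Step P (T P r) c (ℓ'' , σ) →
  Pow k (Star (StepIn P T') ⨾ Step P (T P s)) (ℓ'' , σ) c' →
  fin k ≤∞ evalB ∣ σ ∣ₛ (RB r)

-- Twn-loops (ψ, φ, η) over {x₁,…,x_d} (the order is the one of xs)

record Loop (d : ℕ) : Set where
  constructor loop
  field
    xs : Vec Var d
    ψ  : Formula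
    φ  : Formula
    η  : Var → Poly
open Loop public

loopProgram : ∀ {d} → Loop d → Program
loopProgram {d} L = program (Vec.toList (xs L)) 2 TL 0
  where
  TL : Fin 2 → Trans
  TL Fin.zero = trans 0 (ψ L) var 1
  TL (Fin.suc _) = trans 1 (φ L) (η L) 1

Terminating : Program → Set
Terminating P =
  ¬ (Σ (ℕ → Config) λ f → proj₁ (f 0) ≡ ℓ₀ P × (∀ k → StepAll P (f k) (f (suc k))))

laterVars : ∀ {d} → Vec Var d → Fin d → List Var
laterVars xs i = List.drop (suc (toℕ i)) (Vec.toList xs)

TriangularWith : ∀ {d} → (ℤ → Set) → Loop d → Set
TriangularWith Cond L =
  ∀ i → Σ ℤ λ c → Σ Poly λ p → Cond c × PolyOver (laterVars (xs L) i) p ×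
        (∀ σ → ⟦ η L (Vec.lookup (xs L) i) ⟧ σ ≡ c ℤ.* σ (Vec.lookup (xs L) i) ℤ.+ ⟦ p ⟧ σ)

LoopBase : ∀ {d} → Loop d → Set
LoopBase L = FormulaOver (Vec.toList (xs L)) (ψ L) × FormulaOver (Vec.toList (xs L)) (φ L) ×
             (∀ σ → ⟦ ψ L ⟧F σ → ⟦ substF (Vec.toList (xs L)) (η L) (ψ L) ⟧F σ)

IsTwnLoop : ∀ {d} → Loop d → Set
IsTwnLoop L = LoopBase L × TriangularWith (λ _ → ⊤) L

IsTnnLoop : ∀ {d} → Loop d → Set
IsTnnLoop L = LoopBase L × TriangularWith (λ c → ℤ.0ℤ ℤ.≤ c) L

_⋆_ : ∀ {d} → Loop d → Loop d → Loop d
L ⋆ _ = loop (xs L) (ψ L) (φ L ⋀ substF (Vec.toList (xs L)) (η L) (φ L))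
             (λ v → substP (Vec.toList (xs L)) (η L) (η L v))

-- Exponential polynomials  Σ c · x^m · n^a · b^n
-- a term is ((m , a , b) , c) with m a monomial exponent vector

Mono : ℕ → Set
Mono d = Vec ℕ d

Key : ℕ → Set
Key d = Mono d × ℕ × ℕ

keyDec : ∀ {d} → DecidableEquality (Key d)
keyDec = ProdP.≡-dec (VecP.≡-dec ℕ._≟_) (ProdP.≡-dec ℕ._≟_ ℕ._≟_)

evalMono : ∀ {d} → Vec ℤ d → Mono d → ℤ
evalMono [] [] = ℤ.1ℤ
evalMono (e ∷ es) (m ∷ ms) = (e ℤ.^ m) ℤ.* evalMono es ms

toℚ : ℤ → ℚ
toℚ z = z ℚ./ 1

expN : ℕ → ℕ → ℕ → ℕ
expN a b n = (n ℕ.^ a) ℕ.* (b ℕ.^ n)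

evalQ : ∀ {d} → Vec ℤ d → ℕ → List (Key d × ℚ) → ℚ
evalQ e n = foldr (λ { ((m , a , b) , c) acc → c ℚ.* toℚ (evalMono e m) ℚ.* toℚ (+ expN a b n) ℚ.+ acc }) 0ℚ

evalZ : ∀ {d} → Vec ℤ d → ℕ → List (Key d × ℤ) → ℤ
evalZ e n = foldr (λ { ((m , a , b) , c) acc → c ℤ.* evalMono e m ℤ.* (+ expN a b n) ℤ.+ acc }) ℤ.0ℤ

module _ {K C : Set} (_≟K_ : DecidableEquality K) (_+C_ : C → C → C) where
  insertMerge : K × C → List (K × C) → List (K × C)
  insertMerge (k , c) [] = [ (k , c) ]
  insertMerge (k , c) ((k' , c') ∷ rest) =
    if does (k ≟K k') then (k' , (c +C c')) ∷ rest else (k' , c') ∷ insertMerge (k , c) rest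

  mergeAll : List (K × C) → List (K × C)
  mergeAll = foldr insertMerge []

normQ : ∀ {d} → List (Key d × ℚ) → List (Key d × ℚ)
normQ ts = filterᵇ (λ t → not (does (proj₂ t ℚP.≟ 0ℚ))) (mergeAll keyDec ℚ._+_ ts)

normZ : ∀ {d} → List (Key d × ℤ) → List (Key d × ℤ)
normZ ts = filterᵇ (λ t → not (does (proj₂ t ℤ.≟ ℤ.0ℤ))) (mergeAll keyDec ℤ._+_ ts)

σ[_↦_] : ∀ {d} → Vec Var d → Vec ℤ d → State
σ[ [] ↦ [] ] v = ℤ.0ℤ
σ[ x ∷ xs ↦ e ∷ es ] v = if does (v ℕ.≟ x) then e else σ[ xs ↦ es ] v

ClosedForm : ℕ → Set
ClosedForm d = Vec (List (Key d × ℚ)) d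

IsClosedForm : ∀ {d} → Loop d → ClosedForm d → ℕ → Set
IsClosedForm L cf n₀ =
  (∀ i → All (λ t → 1 ℕ.≤ proj₂ (proj₂ (proj₁ t))) (Vec.lookup cf i)) ×
  (∀ i (σ : State) (n : ℕ) → n₀ ℕ.≤ n →
     evalQ (Vec.map σ (xs L)) n (Vec.lookup cf i)
       ≡ toℚ (⟦ iterP (Vec.toList (xs L)) (η L) n (var (Vec.lookup (xs L) i)) ⟧ σ))

zeroMono : ∀ {d} → Mono d
zeroMono = Vec.replicate _ 0

mulT : ∀ {d} → Key d × ℚ → Key d × ℚ → Key d × ℚ
mulT ((m , a , b) , c) ((m' , a' , b') , c') = ((Vec.zipWith ℕ._+_ m m' , a ℕ.+ a' , b ℕ.* b') , c ℚ.* c')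

lookupVar : ∀ {d} {A : Set} → A → Vec Var d → Vec A d → Var → A
lookupVar dflt [] [] v = dflt
lookupVar dflt (x ∷ xs) (a ∷ as) v = if does (v ℕ.≟ x) then a else lookupVar dflt xs as v

expand : ∀ {d} → Vec Var d → ClosedForm d → Poly → List (Key d × ℚ)
expand xs cf (var v) = lookupVar [] xs cf v
expand xs cf (con z) = [ ((zeroMono , 0 , 1) , toℚ z) ]
expand xs cf (p ⊕ q) = expand xs cf p ++ expand xs cf q
expand xs cf (p ⊗ q) = concatMap (λ t → map (mulT t) (expand xs cf q)) (expand xs cf p)
expand xs cf (⊝ p) = map (λ t → (proj₁ t , ℚ.- proj₂ t)) (expand xs cf p)

npe : ∀ {d} → Vec Var d → ClosedForm d → Poly × Poly → List (Key d × ℤ)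
npe xs cf (s₁ , s₂) = map (λ t → (proj₁ t , ↥ (toℚ (+ L) ℚ.* proj₂ t))) N
  where
  N = normQ (expand xs cf (s₂ ⊕ (⊝ s₁)))
  L = foldr lcm 1 (map (λ t → ↧ₙ proj₂ t) N)

-- pairs are (base , exponent), i.e. (b , a) for n^a · b^n
_>lex_ : ℕ × ℕ → ℕ × ℕ → Set
(b₁ , a₁) >lex (b₂ , a₂) = b₂ ℕ.< b₁ ⊎ (b₁ ≡ b₂ × a₂ ℕ.< a₁)

_<lexᵇ_ : ℕ × ℕ → ℕ × ℕ → Bool
(b₁ , a₁) <lexᵇ (b₂ , a₂) = (b₁ <ᵇ b₂) ∨ ((b₁ ≡ᵇ b₂) ∧ (a₁ <ᵇ a₂))

MonoFrom : ℕ → ℕ × ℕ → ℕ × ℕ → ℕ → Set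
MonoFrom k (b₁ , a₁) (b₂ , a₂) m = ∀ n → m ℕ.≤ n → k ℕ.* expN a₂ b₂ n ℕ.< expN a₁ b₁ n

IsMonoThreshold : ℕ → ℕ × ℕ → ℕ × ℕ → ℕ → Set
IsMonoThreshold k p₁ p₂ m = MonoFrom k p₁ p₂ m × (∀ m' → MonoFrom k p₁ p₂ m' → m ℕ.≤ m')

-- Δ/Γ membership with the chosen (i , j)
data Tag : Set where
  none : Tag
  inΔ  : ℕ → ℕ → Tag
  inΓ  : ℕ → ℕ → Tag

-- ingredient of a maximum: a constant or a k-monotonicity threshold
data Item : Set where
  cst : ℕ → Item
  thr : ℕ → ℕ × ℕ → ℕ × ℕ → Item

itemVal : (ℕ → ℕ × ℕ → ℕ × ℕ → ℕ) → Item → ℕ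
itemVal mt (cst n) = n
itemVal mt (thr k p₁ p₂) = mt k p₁ p₂

ItemOK : (ℕ → ℕ × ℕ → ℕ × ℕ → ℕ) → Item → Set
ItemOK mt (cst n) = ⊤
ItemOK mt (thr k p₁ p₂) = IsMonoThreshold k p₁ p₂ (mt k p₁ p₂)

Tagged : Tag → Set
Tagged none = Data.Empty.⊥
  where import Data.Empty
Tagged (inΔ _ _) = ⊤
Tagged (inΓ _ _) = ⊤

module StabDefs {d : ℕ} (L : Loop d) where
  ψ' : Formula
  ψ' = ψ L ⋀ φ L

  as : List (Poly × Poly)
  as = atoms (φ L)

  Λ : ClosedForm d → Fin (length as) → List (Key d × ℤ)
  Λ cf α = npe (xs L) cf (List.lookup as α)

  Tags : ClosedForm d → Set
  Tags cf = (α : Fin (length as)) → Fin (length (Λ cf α)) → Tag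

  tagged : (cf : ClosedForm d) → Tags cf → Fin (length as) → List ((Key d × ℤ) × Tag)
  tagged cf τ α = tabulate (λ k → (List.lookup (Λ cf α) k , τ α k))

  TagValid : (Key d × ℤ) × Tag → Set
  TagValid (_ , none) = ⊤
  TagValid (((m , a , b) , c) , inΔ i j) =
    (∀ σ → ⟦ ψ' ⟧F σ → ℤ.0ℤ ℤ.< c ℤ.* evalMono (Vec.map σ (xs L)) m) × ((j , i) >lex (b , a))
  TagValid (((m , a , b) , c) , inΓ i j) =
    (∀ σ → ⟦ ψ' ⟧F σ → c ℤ.* evalMono (Vec.map σ (xs L)) m ℤ.≤ ℤ.0ℤ) × ((b , a) >lex (j , i))

  replaced : (Key d × ℤ) × Tag → Key d × ℤ
  replaced (t , none) = t
  replaced (((m , a , b) , c) , inΔ i j) = ((m , i , j) , c)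
  replaced (((m , a , b) , c) , inΓ i j) = ((m , i , j) , c)

  npeBar : (cf : ClosedForm d) → Tags cf → Fin (length as) → List (Key d × ℤ)
  npeBar cf τ α = map replaced (tagged cf τ α)

  EventuallyNonPos : (cf : ClosedForm d) → Tags cf → Set
  EventuallyNonPos cf τ = ∀ α → Any (λ t → Tagged (proj₂ t)) (tagged cf τ α) →
    ∀ (e : Vec ℤ d) → ⟦ ψ' ⟧F (σ[ xs L ↦ e ]) →
    Σ ℕ λ N → ∀ n → N ℕ.≤ n → evalZ e n (npeBar cf τ α) ℤ.≤ ℤ.0ℤ

  Ditem : (Key d × ℤ) × Tag → List Item
  Ditem (_ , none) = []
  Ditem (((m , a , b) , c) , inΔ i j) = [ thr 1 (j , i) (b , a) ]
  Ditem (((m , a , b) , c) , inΓ i j) = [ thr 1 (b , a) (j , i) ]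

  -- \overline{npe_α} = Σ_{j=1}^{ℓ} p_j n^{a_j} b_j^n with p_j ≠ 0, sorted increasingly w.r.t. (b_j,a_j)
  Group : Set
  Group = (ℕ × ℕ) × List (Mono d × ℤ)

  insertSorted : Group → List Group → List Group
  insertSorted g [] = [ g ]
  insertSorted g (h ∷ hs) = if proj₁ g <lexᵇ proj₁ h then g ∷ h ∷ hs else h ∷ insertSorted g hs

  groups : List (Key d × ℤ) → List Group
  groups ts = foldr insertSorted []
    (mergeAll (ProdP.≡-dec ℕ._≟_ ℕ._≟_) _++_
      (map (λ { ((m , a , b) , c) → ((b , a) , [ (m , c) ]) }) (normZ ts)))

  -- (b_j , a_j), 1-based
  key : List Group → ℕ → ℕ × ℕ
  key gs j = nth gs (j ∸ 1)
    where
    nth : List Group → ℕ → ℕ × ℕ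
    nth [] _ = (0 , 0)
    nth (g ∷ _) zero = proj₁ g
    nth (_ ∷ gs') (suc i) = nth gs' i

  Mitem : List Group → ℕ → Item
  Mitem gs j = if proj₁ (key gs j) ≡ᵇ proj₁ (key gs (j ∸ 1)) then cst 0
               else thr 1 (key gs j) (proj₁ (key gs (j ∸ 1)) , suc (proj₂ (key gs (j ∸ 1))))

  Nitems : List Group → ℕ → List Item
  Nitems gs zero = []
  Nitems gs (suc zero) = []
  Nitems gs (suc (suc zero)) = [ cst 1 ]
  Nitems gs j@(suc (suc (suc _))) =
    thr (j ∸ 2) (key gs (j ∸ 1)) (key gs (j ∸ 2)) ∷
    map (λ i → thr 1 (key gs (j ∸ 2)) (key gs i)) (map suc (upTo (j ∸ 3)))

  Citems : List Group → List Item
  Citems gs = cst 1 ∷ concatMap (λ j → Mitem gs j ∷ Nitems gs j) (map (λ k → k ℕ.+ 2) (upTo (length gs ∸ 1)))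

  allItems : ℕ → (cf : ClosedForm d) → Tags cf → List Item
  allItems n₀ cf τ = cst n₀ ∷ concatMap (λ α →
      Citems (groups (npeBar cf τ α)) ++ concatMap Ditem (tagged cf τ α)) (tabulate (λ α → α))

  Pol : (cf : ClosedForm d) → Tags cf → List (List (Mono d × ℤ))
  Pol cf τ = concatMap (λ α → let gs = groups (npeBar cf τ α) in
                               map proj₂ (List.take (length gs ∸ 1) gs)) (tabulate (λ α → α))

  monoBound : ∀ {k} → Vec Var k → Mono k → Bound
  monoBound [] [] = nat 1
  monoBound (x ∷ ys) (m ∷ ms) = foldr _⊠_ (nat 1) (List.replicate m (bvar x)) ⊠ monoBound ys ms

  supBound : List (List (Mono d × ℤ)) → Bound
  supBound ps = foldr (λ t acc → (nat (proj₂ t) ⊠ monoBound (xs L) (proj₁ t)) ⊞ acc) (nat 0)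
    (mergeAll (VecP.≡-dec ℕ._≟_) ℕ._⊔_ (map (λ t → (proj₁ t , ∣ proj₂ t ∣)) (List.concat ps)))

  MTFun : Set
  MTFun = ℕ → ℕ × ℕ → ℕ × ℕ → ℕ

  sthOf : (n₀ : ℕ) (cf : ClosedForm d) → Tags cf → MTFun → Bound
  sthOf n₀ cf τ mt =
    (nat 2 ⊠ supBound (Pol cf τ)) ⊞ nat (foldr ℕ._⊔_ 0 (map (itemVal mt) (allItems n₀ cf τ)))

  -- q is obtained by the construction for some admissible choice of
  -- closed form (with start value n₀), Δ, Γ, i, j; mt gives the monotonicity thresholds used
  IsStabBoundPoly : Bound → Set
  IsStabBoundPoly q =
    Σ ℕ λ n₀ → Σ (ClosedForm d) λ cf → IsClosedForm L cf n₀ ×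
    Σ (Tags cf) λ τ → (∀ α → All TagValid (tagged cf τ α)) × EventuallyNonPos cf τ ×
    Σ MTFun λ mt → All (ItemOK mt) (allItems n₀ cf τ) ×
    q ≡ sthOf n₀ cf τ mt

IsStabBound : ∀ {d} → Loop d → Bound → Set
IsStabBound L q = StabDefs.IsStabBoundPoly L q

module Submission where

-- Along a run of t entered in a state σ satisfying ψ, the variables xs pass through the orbit
-- σ, η(σ), η²(σ), …, so it suffices to bound how long the guard φ stays true on this orbit.
-- For a tnn-loop an atom s₁ < s₂ of φ holds at ηⁿ(σ) iff npe(n) > 0, where npe is an
-- exponential sum Σⱼ pⱼ(σ) n^{aⱼ} bⱼⁿ. Replacing the Δ/Γ terms can only increase npe, and from
-- B = 2·⊔Pol(σ) + max{n₀, C, D} on the last nonzero term of the modified sum dominates the rest,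
-- so its positivity at B persists. Without replacements an atom true at B thus stays true; with
-- them it cannot be true at B, the modified sum being eventually non-positive. So if φ held at B
-- it would hold forever, contradicting termination, and the run is shorter than B.
-- A twn-loop is treated through the tnn-loop L ⋆ L, one step of which is two steps of L.

open import Defs hiding (trans)
open import Algebra.Bundles using (CommutativeMonoid)
import Algebra.Properties.CommutativeSemigroup as CommSemigroupProperties
open import Data.Bool using (Bool; true; false; if_then_else_; not) renaming (T to IsTrue; T? to IsTrue?)
open import Data.Bool.Properties using (T-∨; T-∧)
open import Data.Empty using (⊥-elim)
open import Data.Fin as Fin using (Fin)
open import Data.Integer as ℤ using (ℤ; +_; -[1+_]; +[1+_]; 0ℤ; 1ℤ)
import Data.Integer.GCD as ℤ
import Data.Integer.Properties as ℤₚ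
open import Data.List as List
  using (List; []; _∷_; [_]; _++_; map; foldr; filterᵇ; length; concat; concatMap; tabulate; upTo; take; replicate)
open import Data.List.Membership.Propositional using (_∈_; _∉_)
open import Data.List.Membership.Propositional.Properties
  using (∈-++⁺ˡ; ∈-++⁺ʳ; ∈-++⁻; ∈-map⁺; ∈-map⁻; ∈-∃++; ∈-concat⁺′; ∈-concatMap⁺; ∈-tabulate⁺; ∈-upTo⁺)
open import Data.List.Relation.Unary.All as All using (All; []; _∷_)
open import Data.List.Relation.Unary.AllPairs using (AllPairs; []; _∷_)
import Data.List.Relation.Unary.AllPairs.Properties as AllPairs
open import Data.List.Relation.Unary.Any as Any using (Any; here; there; any?)
open import Data.List.Relation.Unary.Any.Properties using (lookup-index)
open import Data.List.Relation.Unary.Unique.Propositional using (Unique)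
open import Data.Nat as ℕ using (ℕ; zero; suc; _≤_; _<_; z≤n; s≤s; _∸_; _⊔_)
open import Data.Nat.Divisibility using (_∣_; divides; ∣-trans)
open import Data.Nat.GCD using (gcd)
open import Data.Nat.LCM using (lcm; m∣lcm[m,n]; n∣lcm[m,n]; gcd*lcm)
import Data.Nat.Properties as ℕₚ
open import Data.List.Membership.DecPropositional ℕ._≟_ using (_∈?_)
open import Data.Product using (Σ; ∃; _×_; _,_; proj₁; proj₂)
import Data.Product.Properties as ×ₚ
open import Data.Rational as ℚ using (ℚ; mkℚ; ↥_; ↧_; ↧ₙ_; 0ℚ; toℚᵘ)
import Data.Rational.Properties as ℚₚ
open import Data.Rational.Unnormalised as ℚᵘ using (mkℚᵘ; *≡*)
import Data.Rational.Unnormalised.Properties as ℚᵘₚ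
open import Data.Sum using (_⊎_; inj₁; inj₂)
open import Data.Unit using (tt)
open import Data.Vec as Vec using (Vec; []; _∷_; toList)
import Data.Vec.Properties as Vecₚ
open import Function using (_∘_; id; _⇔_; mk⇔; Equivalence)
open import Level using (0ℓ)
open import Relation.Binary.Construct.Closure.ReflexiveTransitive using (Star; ε; _◅_)
open import Relation.Binary.Definitions using (DecidableEquality; tri<; tri≈; tri>)
open import Relation.Binary.PropositionalEquality
  using (_≡_; _≢_; _≗_; refl; sym; trans; cong; cong₂; subst; subst₂; module ≡-Reasoning)
open import Relation.Nullary using (¬_; Dec; yes; no; does)
open import Relation.Nullary.Decidable using (dec-false; decidable-stable)

update : List Var → (Var → Poly) → State → State
update PV η σ v = if does (v ∈? PV) then ⟦ η v ⟧ σ else σ v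

updateⁿ : List Var → (Var → Poly) → ℕ → State → State
updateⁿ PV η zero σ = σ
updateⁿ PV η (suc n) σ = updateⁿ PV η n (update PV η σ)

⟦⟧-cong : ∀ p {σ τ} → σ ≗ τ → ⟦ p ⟧ σ ≡ ⟦ p ⟧ τ
⟦⟧-cong (var v) σ≗τ = σ≗τ v
⟦⟧-cong (con z) σ≗τ = refl
⟦⟧-cong (p ⊕ q) σ≗τ = cong₂ ℤ._+_ (⟦⟧-cong p σ≗τ) (⟦⟧-cong q σ≗τ)
⟦⟧-cong (p ⊗ q) σ≗τ = cong₂ ℤ._*_ (⟦⟧-cong p σ≗τ) (⟦⟧-cong q σ≗τ)
⟦⟧-cong (⊝ p) σ≗τ = cong ℤ.-_ (⟦⟧-cong p σ≗τ)

⟦⟧F-cong : ∀ φ {σ τ} → σ ≗ τ → ⟦ φ ⟧F σ ≡ ⟦ φ ⟧F τ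
⟦⟧F-cong (p ≺ q) σ≗τ = cong₂ ℤ._<_ (⟦⟧-cong p σ≗τ) (⟦⟧-cong q σ≗τ)
⟦⟧F-cong (φ ⋀ ψ) σ≗τ = cong₂ _×_ (⟦⟧F-cong φ σ≗τ) (⟦⟧F-cong ψ σ≗τ)
⟦⟧F-cong (φ ⋁ ψ) σ≗τ = cong₂ _⊎_ (⟦⟧F-cong φ σ≗τ) (⟦⟧F-cong ψ σ≗τ)

update-cong : ∀ PV η {σ τ} → σ ≗ τ → update PV η σ ≗ update PV η τ
update-cong PV η σ≗τ v with does (v ∈? PV)
... | true = ⟦⟧-cong (η v) σ≗τ
... | false = σ≗τ v

updateⁿ-cong : ∀ PV η n {σ τ} → σ ≗ τ → updateⁿ PV η n σ ≗ updateⁿ PV η n τ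
updateⁿ-cong PV η zero σ≗τ = σ≗τ
updateⁿ-cong PV η (suc n) σ≗τ = updateⁿ-cong PV η n (update-cong PV η σ≗τ)

updateⁿ-suc : ∀ PV η n σ → updateⁿ PV η (suc n) σ ≗ update PV η (updateⁿ PV η n σ)
updateⁿ-suc PV η zero σ v = refl
updateⁿ-suc PV η (suc n) σ = updateⁿ-suc PV η n (update PV η σ)

update-∈ : ∀ PV η σ {v} → v ∈ PV → update PV η σ v ≡ ⟦ η v ⟧ σ
update-∈ PV η σ {v} v∈PV with v ∈? PV
... | yes _ = refl
... | no v∉PV = ⊥-elim (v∉PV v∈PV)

⟦substP⟧ : ∀ PV η p σ → ⟦ substP PV η p ⟧ σ ≡ ⟦ p ⟧ (update PV η σ)
⟦substP⟧ PV η (var v) σ with does (v ∈? PV)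
... | true = refl
... | false = refl
⟦substP⟧ PV η (con z) σ = refl
⟦substP⟧ PV η (p ⊕ q) σ = cong₂ ℤ._+_ (⟦substP⟧ PV η p σ) (⟦substP⟧ PV η q σ)
⟦substP⟧ PV η (p ⊗ q) σ = cong₂ ℤ._*_ (⟦substP⟧ PV η p σ) (⟦substP⟧ PV η q σ)
⟦substP⟧ PV η (⊝ p) σ = cong ℤ.-_ (⟦substP⟧ PV η p σ)

⟦substF⟧ : ∀ PV η φ σ → ⟦ substF PV η φ ⟧F σ ≡ ⟦ φ ⟧F (update PV η σ)
⟦substF⟧ PV η (p ≺ q) σ = cong₂ ℤ._<_ (⟦substP⟧ PV η p σ) (⟦substP⟧ PV η q σ)
⟦substF⟧ PV η (φ ⋀ ψ) σ = cong₂ _×_ (⟦substF⟧ PV η φ σ) (⟦substF⟧ PV η ψ σ)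
⟦substF⟧ PV η (φ ⋁ ψ) σ = cong₂ _⊎_ (⟦substF⟧ PV η φ σ) (⟦substF⟧ PV η ψ σ)

⟦iterP⟧ : ∀ PV η n p σ → ⟦ iterP PV η n p ⟧ σ ≡ ⟦ p ⟧ (updateⁿ PV η n σ)
⟦iterP⟧ PV η zero p σ = refl
⟦iterP⟧ PV η (suc n) p σ = trans (⟦substP⟧ PV η (iterP PV η n p) σ) (⟦iterP⟧ PV η n p (update PV η σ))

AgreeOn : List Var → State → State → Set
AgreeOn S σ τ = ∀ {v} → v ∈ S → σ v ≡ τ v

⟦⟧-agree : ∀ {S} p {σ τ} → PolyOver S p → AgreeOn S σ τ → ⟦ p ⟧ σ ≡ ⟦ p ⟧ τ
⟦⟧-agree (var v) v∈S agree = agree v∈S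
⟦⟧-agree (con z) _ agree = refl
⟦⟧-agree (p ⊕ q) (p∈ , q∈) agree = cong₂ ℤ._+_ (⟦⟧-agree p p∈ agree) (⟦⟧-agree q q∈ agree)
⟦⟧-agree (p ⊗ q) (p∈ , q∈) agree = cong₂ ℤ._*_ (⟦⟧-agree p p∈ agree) (⟦⟧-agree q q∈ agree)
⟦⟧-agree (⊝ p) p∈ agree = cong ℤ.-_ (⟦⟧-agree p p∈ agree)

⟦⟧F-agree : ∀ {S} φ {σ τ} → FormulaOver S φ → AgreeOn S σ τ → ⟦ φ ⟧F σ ≡ ⟦ φ ⟧F τ
⟦⟧F-agree (p ≺ q) (p∈ , q∈) agree = cong₂ ℤ._<_ (⟦⟧-agree p p∈ agree) (⟦⟧-agree q q∈ agree)
⟦⟧F-agree (φ ⋀ ψ) (φ∈ , ψ∈) agree = cong₂ _×_ (⟦⟧F-agree φ φ∈ agree) (⟦⟧F-agree ψ ψ∈ agree)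
⟦⟧F-agree (φ ⋁ ψ) (φ∈ , ψ∈) agree = cong₂ _⊎_ (⟦⟧F-agree φ φ∈ agree) (⟦⟧F-agree ψ ψ∈ agree)

σ[↦map]-agree : ∀ {d} (xs : Vec Var d) σ → AgreeOn (toList xs) σ (σ[ xs ↦ Vec.map σ xs ])
σ[↦map]-agree (x ∷ xs) σ {v} v∈ with v ℕ.≡ᵇ x in v≡ᵇx
... | true = cong σ (ℕₚ.≡ᵇ⇒≡ v x (subst IsTrue (sym v≡ᵇx) tt))
... | false with v∈
...   | here v≡x = ⊥-elim (subst IsTrue v≡ᵇx (ℕₚ.≡⇒≡ᵇ v x v≡x))
...   | there v∈xs = σ[↦map]-agree xs σ v∈xs

AtomHolds : State → Poly × Poly → Set
AtomHolds σ (p , q) = ⟦ p ⟧ σ ℤ.< ⟦ q ⟧ σ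

⟦⟧F-mono : ∀ φ {σ τ} → (∀ {a} → a ∈ atoms φ → AtomHolds σ a → AtomHolds τ a) → ⟦ φ ⟧F σ → ⟦ φ ⟧F τ
⟦⟧F-mono (p ≺ q) h holds = h (here refl) holds
⟦⟧F-mono (φ ⋀ ψ) h (φσ , ψσ) = ⟦⟧F-mono φ (h ∘ ∈-++⁺ˡ) φσ , ⟦⟧F-mono ψ (h ∘ ∈-++⁺ʳ (atoms φ)) ψσ
⟦⟧F-mono (φ ⋁ ψ) h (inj₁ φσ) = inj₁ (⟦⟧F-mono φ (h ∘ ∈-++⁺ˡ) φσ)
⟦⟧F-mono (φ ⋁ ψ) h (inj₂ ψσ) = inj₂ (⟦⟧F-mono ψ (h ∘ ∈-++⁺ʳ (atoms φ)) ψσ)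

atoms-over : ∀ {S} φ → FormulaOver S φ → ∀ {a} → a ∈ atoms φ → PolyOver S (proj₁ a) × PolyOver S (proj₂ a)
atoms-over (p ≺ q) over (here refl) = over
atoms-over (φ ⋀ ψ) (φ∈ , ψ∈) a∈ with ∈-++⁻ (atoms φ) a∈
... | inj₁ a∈φ = atoms-over φ φ∈ a∈φ
... | inj₂ a∈ψ = atoms-over ψ ψ∈ a∈ψ
atoms-over (φ ⋁ ψ) (φ∈ , ψ∈) a∈ with ∈-++⁻ (atoms φ) a∈
... | inj₁ a∈φ = atoms-over φ φ∈ a∈φ
... | inj₂ a∈ψ = atoms-over ψ ψ∈ a∈ψ

substP-over : ∀ {S} η p → (∀ {v} → v ∈ S → PolyOver S (η v)) → PolyOver S p → PolyOver S (substP S η p)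
substP-over {S} η (var v) ηS over with v ∈? S
... | yes v∈S = ηS v∈S
... | no _ = over
substP-over η (con z) ηS over = over
substP-over η (p ⊕ q) ηS (p∈ , q∈) = substP-over η p ηS p∈ , substP-over η q ηS q∈
substP-over η (p ⊗ q) ηS (p∈ , q∈) = substP-over η p ηS p∈ , substP-over η q ηS q∈
substP-over η (⊝ p) ηS over = substP-over η p ηS over

substF-over : ∀ {S} η φ → (∀ {v} → v ∈ S → PolyOver S (η v)) → FormulaOver S φ → FormulaOver S (substF S η φ)
substF-over η (p ≺ q) ηS (p∈ , q∈) = substP-over η p ηS p∈ , substP-over η q ηS q∈
substF-over η (φ ⋀ ψ) ηS (φ∈ , ψ∈) = substF-over η φ ηS φ∈ , substF-over η ψ ηS ψ∈
substF-over η (φ ⋁ ψ) ηS (φ∈ , ψ∈) = substF-over η φ ηS φ∈ , substF-over η ψ ηS ψ∈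

module MonoidSum (M : CommutativeMonoid 0ℓ 0ℓ) where
  open CommutativeMonoid M
    using (_≈_; _∙_; ∙-cong; ∙-congˡ; ∙-congʳ; identityˡ; assoc; commutativeSemigroup; setoid)
    renaming (Carrier to C; ε to 0#; refl to ≈-refl; sym to ≈-sym; trans to ≈-trans)
  open CommSemigroupProperties commutativeSemigroup using (x∙yz≈y∙xz)
  open import Relation.Binary.Reasoning.Setoid setoid

  sumBy : {A : Set} → (A → C) → List A → C
  sumBy f = foldr (λ x acc → f x ∙ acc) 0#

  sumBy-++ : {A : Set} (f : A → C) → ∀ xs ys → sumBy f (xs ++ ys) ≈ sumBy f xs ∙ sumBy f ys
  sumBy-++ f [] ys = ≈-sym (identityˡ _)
  sumBy-++ f (x ∷ xs) ys = begin
    f x ∙ sumBy f (xs ++ ys)          ≈⟨ ∙-congˡ (sumBy-++ f xs ys) ⟩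
    f x ∙ (sumBy f xs ∙ sumBy f ys)   ≈⟨ ≈-sym (assoc _ _ _) ⟩
    (f x ∙ sumBy f xs) ∙ sumBy f ys   ∎

  sumBy-filterᵇ : {A : Set} (f : A → C) (p : A → Bool) → (∀ x → p x ≡ false → f x ≈ 0#) →
                  ∀ xs → sumBy f (filterᵇ p xs) ≈ sumBy f xs
  sumBy-filterᵇ f p dropped≈0# [] = ≈-refl
  sumBy-filterᵇ f p dropped≈0# (x ∷ xs) with p x in px
  ... | true = ∙-congˡ (sumBy-filterᵇ f p dropped≈0# xs)
  ... | false = begin
    sumBy f (filterᵇ p xs)   ≈⟨ sumBy-filterᵇ f p dropped≈0# xs ⟩
    sumBy f xs               ≈⟨ ≈-sym (identityˡ _) ⟩
    0# ∙ sumBy f xs          ≈⟨ ∙-congʳ (≈-sym (dropped≈0# x px)) ⟩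
    f x ∙ sumBy f xs         ∎

  sumBy-cong : {A : Set} {f g : A → C} → (∀ x → f x ≈ g x) → ∀ xs → sumBy f xs ≈ sumBy g xs
  sumBy-cong f≈g [] = ≈-refl
  sumBy-cong f≈g (x ∷ xs) = ∙-cong (f≈g x) (sumBy-cong f≈g xs)

  sumBy-map : {A B : Set} (f : B → C) (g : A → B) → ∀ xs → sumBy f (map g xs) ≈ sumBy (f ∘ g) xs
  sumBy-map f g [] = ≈-refl
  sumBy-map f g (x ∷ xs) = ∙-congˡ (sumBy-map f g xs)

  module _ {K V : Set} (_≟_ : DecidableEquality K) (_+V_ : V → V → V) (f : K × V → C)
           (f-+V : ∀ k u v → f (k , u +V v) ≈ f (k , u) ∙ f (k , v)) where

    sumBy-insertMerge : ∀ kv kvs → sumBy f (insertMerge _≟_ _+V_ kv kvs) ≈ f kv ∙ sumBy f kvs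
    sumBy-insertMerge kv [] = ≈-refl
    sumBy-insertMerge (k , u) ((k′ , v) ∷ kvs) with k ≟ k′
    ... | yes refl = ≈-trans (∙-congʳ (f-+V k u v)) (assoc _ _ _)
    ... | no _ = ≈-trans (∙-congˡ (sumBy-insertMerge (k , u) kvs)) (x∙yz≈y∙xz _ _ _)

    sumBy-mergeAll : ∀ kvs → sumBy f (mergeAll _≟_ _+V_ kvs) ≈ sumBy f kvs
    sumBy-mergeAll [] = ≈-refl
    sumBy-mergeAll (kv ∷ kvs) =
      ≈-trans (sumBy-insertMerge kv (mergeAll _≟_ _+V_ kvs)) (∙-congˡ (sumBy-mergeAll kvs))

keys : {K V : Set} → List (K × V) → List K
keys = map proj₁

module _ {K V : Set} (_≟_ : DecidableEquality K) (_+V_ : V → V → V) where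

  keys-insertMerge : ∀ k v kvs {k′} → k′ ∈ keys (insertMerge _≟_ _+V_ (k , v) kvs) → k′ ≡ k ⊎ k′ ∈ keys kvs
  keys-insertMerge k v [] (here refl) = inj₁ refl
  keys-insertMerge k v ((k₁ , v₁) ∷ kvs) k′∈ with k ≟ k₁
  ... | yes refl = inj₂ k′∈
  ... | no _ with k′∈
  ...   | here refl = inj₂ (here refl)
  ...   | there k′∈′ with keys-insertMerge k v kvs k′∈′
  ...     | inj₁ k′≡k = inj₁ k′≡k
  ...     | inj₂ k′∈kvs = inj₂ (there k′∈kvs)

  insertMerge-unique : ∀ k v kvs → Unique (keys kvs) → Unique (keys (insertMerge _≟_ _+V_ (k , v) kvs))
  insertMerge-unique k v [] _ = [] ∷ []
  insertMerge-unique k v ((k₁ , v₁) ∷ kvs) (k₁∉ ∷ uniq) with k ≟ k₁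
  ... | yes refl = k₁∉ ∷ uniq
  ... | no k≢k₁ = All.tabulate k₁≢ ∷ insertMerge-unique k v kvs uniq
    where
    k₁≢ : ∀ {k′} → k′ ∈ keys (insertMerge _≟_ _+V_ (k , v) kvs) → k₁ ≢ k′
    k₁≢ k′∈ with keys-insertMerge k v kvs k′∈
    ... | inj₁ refl = λ k₁≡k → k≢k₁ (sym k₁≡k)
    ... | inj₂ k′∈kvs = All.lookup k₁∉ k′∈kvs

  mergeAll-unique : ∀ kvs → Unique (keys (mergeAll _≟_ _+V_ kvs))
  mergeAll-unique [] = []
  mergeAll-unique ((k , v) ∷ kvs) = insertMerge-unique k v (mergeAll _≟_ _+V_ kvs) (mergeAll-unique kvs)

filterᵇ-unique-keys : {K V : Set} (p : K × V → Bool) → ∀ kvs → Unique (keys kvs) → Unique (keys (filterᵇ p kvs))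
filterᵇ-unique-keys p kvs = AllPairs.map⁺ ∘ AllPairs.filter⁺ (IsTrue? ∘ p) ∘ AllPairs.map⁻

DominatedIn : {K : Set} → List (K × ℕ) → K × ℕ → Set
DominatedIn kvs (k , v) = ∃ λ v′ → (k , v′) ∈ kvs × v ≤ v′

module _ {K : Set} (_≟_ : DecidableEquality K) where

  insertMerge-⊔-dominates-∈ : ∀ kv kvs {kv′} → kv′ ∈ kvs → DominatedIn (insertMerge _≟_ _⊔_ kv kvs) kv′
  insertMerge-⊔-dominates-∈ (k , v) ((k₁ , v₁) ∷ kvs) kv′∈ with k ≟ k₁
  insertMerge-⊔-dominates-∈ (k , v) ((k₁ , v₁) ∷ kvs) (here refl) | yes refl = _ , here refl , ℕₚ.m≤n⊔m v v₁
  insertMerge-⊔-dominates-∈ (k , v) ((k₁ , v₁) ∷ kvs) (there kv′∈) | yes refl = _ , there kv′∈ , ℕₚ.≤-refl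
  insertMerge-⊔-dominates-∈ (k , v) ((k₁ , v₁) ∷ kvs) (here refl) | no _ = _ , here refl , ℕₚ.≤-refl
  insertMerge-⊔-dominates-∈ (k , v) ((k₁ , v₁) ∷ kvs) (there kv′∈) | no _
    with v′ , ∈ins , le ← insertMerge-⊔-dominates-∈ (k , v) kvs kv′∈ = v′ , there ∈ins , le

  insertMerge-⊔-dominates-inserted : ∀ kv kvs → DominatedIn (insertMerge _≟_ _⊔_ kv kvs) kv
  insertMerge-⊔-dominates-inserted (k , v) [] = v , here refl , ℕₚ.≤-refl
  insertMerge-⊔-dominates-inserted (k , v) ((k₁ , v₁) ∷ kvs) with k ≟ k₁
  ... | yes refl = _ , here refl , ℕₚ.m≤m⊔n v v₁
  ... | no _ with v′ , ∈ins , le ← insertMerge-⊔-dominates-inserted (k , v) kvs = v′ , there ∈ins , le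

  mergeAll-⊔-dominates : ∀ kvs {kv} → kv ∈ kvs → DominatedIn (mergeAll _≟_ _⊔_ kvs) kv
  mergeAll-⊔-dominates (kv ∷ kvs) (here refl) = insertMerge-⊔-dominates-inserted kv (mergeAll _≟_ _⊔_ kvs)
  mergeAll-⊔-dominates (kv ∷ kvs) (there kv′∈)
    with v′ , ∈merged , le ← mergeAll-⊔-dominates kvs kv′∈
    with v″ , ∈ins , le′ ← insertMerge-⊔-dominates-∈ kv _ ∈merged = v″ , ∈ins , ℕₚ.≤-trans le le′

module ℕSum = MonoidSum ℕₚ.+-0-commutativeMonoid

weightedSum : {K : Set} → (K → ℕ) → List (K × ℕ) → ℕ
weightedSum w = ℕSum.sumBy (λ (k , c) → c ℕ.* w k)

weightedSum-dominated : {K : Set} (w : K → ℕ) → ∀ kvs out → Unique (keys kvs) →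
                        (∀ {kv} → kv ∈ kvs → DominatedIn out kv) → weightedSum w kvs ≤ weightedSum w out
weightedSum-dominated w [] out _ _ = z≤n
weightedSum-dominated {K} w ((k , c) ∷ kvs) out (k∉ ∷ uniq) dom
  with C , kC∈out , c≤C ← dom (here refl)
  with us , vs , refl ← ∈-∃++ kC∈out = begin
    c ℕ.* w k ℕ.+ S kvs                   ≤⟨ ℕₚ.+-mono-≤ (ℕₚ.*-monoˡ-≤ (w k) c≤C) rest ⟩
    C ℕ.* w k ℕ.+ (S us ℕ.+ S vs)         ≡⟨ x∙yz≈y∙xz (C ℕ.* w k) (S us) (S vs) ⟩
    S us ℕ.+ (C ℕ.* w k ℕ.+ S vs)         ≡⟨ sym (ℕSum.sumBy-++ _ us ((k , C) ∷ vs)) ⟩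
    S (us ++ (k , C) ∷ vs)                ∎
  where
  open ℕₚ.≤-Reasoning
  open CommSemigroupProperties ℕₚ.+-commutativeSemigroup using (x∙yz≈y∙xz)
  S : List (K × ℕ) → ℕ
  S = weightedSum w
  domRest : ∀ {kv} → kv ∈ kvs → DominatedIn (us ++ vs) kv
  domRest kv∈ with C′ , kC′∈ , le ← dom (there kv∈) with ∈-++⁻ us kC′∈
  ... | inj₁ ∈us = C′ , ∈-++⁺ˡ ∈us , le
  ... | inj₂ (here refl) = ⊥-elim (All.lookup k∉ (∈-map⁺ proj₁ kv∈) refl)
  ... | inj₂ (there ∈vs) = C′ , ∈-++⁺ʳ us ∈vs , le
  rest : S kvs ≤ S us ℕ.+ S vs
  rest = ℕₚ.≤-trans (weightedSum-dominated w kvs (us ++ vs) uniq domRest)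
                    (ℕₚ.≤-reflexive (ℕSum.sumBy-++ _ us vs))

-- Exponential sums dominated by their last term

-- Indices run over 1 … k, like the terms p_j n^{a_j} b_j^n of the paper.
sumℕ : (ℕ → ℕ) → ℕ → ℕ
sumℕ f zero = 0
sumℕ f (suc k) = sumℕ f k ℕ.+ f (suc k)

sumℤ : (ℕ → ℤ) → ℕ → ℤ
sumℤ f zero = 0ℤ
sumℤ f (suc k) = sumℤ f k ℤ.+ f (suc k)

InRange : ℕ → ℕ → Set
InRange k i = 1 ≤ i × i ≤ k

InRange-suc : ∀ {k i} → InRange k i → InRange (suc k) i
InRange-suc (1≤i , i≤k) = 1≤i , ℕₚ.m≤n⇒m≤1+n i≤k

InRange-top : ∀ k → InRange (suc k) (suc k)
InRange-top k = s≤s z≤n , ℕₚ.≤-refl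

sumℕ-mono : ∀ f g k → (∀ {i} → InRange k i → f i ≤ g i) → sumℕ f k ≤ sumℕ g k
sumℕ-mono f g zero f≤g = z≤n
sumℕ-mono f g (suc k) f≤g = ℕₚ.+-mono-≤ (sumℕ-mono f g k (f≤g ∘ InRange-suc)) (f≤g (InRange-top k))

sumℕ-zero : ∀ f k → (∀ {i} → InRange k i → f i ≡ 0) → sumℕ f k ≡ 0
sumℕ-zero f k f≡0 = ℕₚ.n≤0⇒n≡0 (ℕₚ.≤-trans (sumℕ-mono f (λ _ → 0) k (ℕₚ.≤-reflexive ∘ f≡0)) (ℕₚ.≤-reflexive (zeros k)))
  where
  zeros : ∀ k → sumℕ (λ _ → 0) k ≡ 0
  zeros zero = refl
  zeros (suc k) = trans (ℕₚ.+-identityʳ _) (zeros k)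

sumℕ-bounded : ∀ f k X → (∀ {i} → InRange k i → f i ≤ X) → sumℕ f k ≤ k ℕ.* X
sumℕ-bounded f zero X f≤X = z≤n
sumℕ-bounded f (suc k) X f≤X =
  ℕₚ.≤-trans (ℕₚ.+-mono-≤ (sumℕ-bounded f k X (f≤X ∘ InRange-suc)) (f≤X (InRange-top k)))
             (ℕₚ.≤-reflexive (ℕₚ.+-comm (k ℕ.* X) X))

sumℕ-*ˡ : ∀ M f k → sumℕ (λ i → M ℕ.* f i) k ≡ M ℕ.* sumℕ f k
sumℕ-*ˡ M f zero = sym (ℕₚ.*-zeroʳ M)
sumℕ-*ˡ M f (suc k) = trans (cong (ℕ._+ M ℕ.* f (suc k)) (sumℕ-*ˡ M f k)) (sym (ℕₚ.*-distribˡ-+ M (sumℕ f k) (f (suc k))))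

sumℤ-zero : ∀ f k → (∀ {i} → InRange k i → f i ≡ 0ℤ) → sumℤ f k ≡ 0ℤ
sumℤ-zero f zero f≡0 = refl
sumℤ-zero f (suc k) f≡0 = cong₂ ℤ._+_ (sumℤ-zero f k (f≡0 ∘ InRange-suc)) (f≡0 (InRange-top k))

sumℤ-truncate : ∀ f j k → j ≤ k → (∀ i → j < i → i ≤ k → f i ≡ 0ℤ) → sumℤ f k ≡ sumℤ f j
sumℤ-truncate f j k j≤k f≡0 with ℕₚ.m≤n⇒m<n∨m≡n j≤k
... | inj₂ refl = refl
sumℤ-truncate f j (suc k) _ f≡0 | inj₁ (s≤s j≤k) = begin
  sumℤ f k ℤ.+ f (suc k)  ≡⟨ cong₂ ℤ._+_ (sumℤ-truncate f j k j≤k (λ i j<i i≤k → f≡0 i j<i (ℕₚ.m≤n⇒m≤1+n i≤k)))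
                                         (f≡0 (suc k) (s≤s j≤k) ℕₚ.≤-refl) ⟩
  sumℤ f j ℤ.+ 0ℤ         ≡⟨ ℤₚ.+-identityʳ (sumℤ f j) ⟩
  sumℤ f j                ∎
  where open ≡-Reasoning

sumℤ-shift : ∀ f k → sumℤ f (suc k) ≡ f 1 ℤ.+ sumℤ (f ∘ suc) k
sumℤ-shift f zero = trans (ℤₚ.+-identityˡ (f 1)) (sym (ℤₚ.+-identityʳ (f 1)))
sumℤ-shift f (suc k) = trans (cong (ℤ._+ f (suc (suc k))) (sumℤ-shift f k)) (ℤₚ.+-assoc (f 1) _ _)

∣sumℤ∣≤sumℕ∣∣ : ∀ (c : ℕ → ℤ) (t : ℕ → ℕ) k → ℤ.∣ sumℤ (λ i → c i ℤ.* + t i) k ∣ ≤ sumℕ (λ i → ℤ.∣ c i ∣ ℕ.* t i) k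
∣sumℤ∣≤sumℕ∣∣ c t zero = z≤n
∣sumℤ∣≤sumℕ∣∣ c t (suc k) =
  ℕₚ.≤-trans (ℤₚ.∣i+j∣≤∣i∣+∣j∣ (sumℤ (λ i → c i ℤ.* + t i) k) (c (suc k) ℤ.* + t (suc k)))
             (ℕₚ.+-mono-≤ (∣sumℤ∣≤sumℕ∣∣ c t k) (ℕₚ.≤-reflexive (ℤₚ.abs-* (c (suc k)) (+ t (suc k)))))

-i≤+∣i∣ : ∀ i → ℤ.- i ℤ.≤ + ℤ.∣ i ∣
-i≤+∣i∣ (+ _) = ℤₚ.neg-≤-pos
-i≤+∣i∣ -[1+ _ ] = ℤₚ.≤-refl

i≤+∣i∣ : ∀ i → i ℤ.≤ + ℤ.∣ i ∣
i≤+∣i∣ (+ _) = ℤₚ.≤-refl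
i≤+∣i∣ -[1+ _ ] = ℤ.-≤+

dominated-sum-pos : ∀ r x t → ℤ.∣ r ∣ < t → + t ℤ.≤ x → 0ℤ ℤ.< r ℤ.+ x
dominated-sum-pos r x t ∣r∣<t t≤x = subst (ℤ._< r ℤ.+ x) (ℤₚ.+-inverseʳ r)
  (ℤₚ.+-monoʳ-< r (ℤₚ.≤-<-trans (-i≤+∣i∣ r) (ℤₚ.<-≤-trans (ℤ.+<+ ∣r∣<t) t≤x)))

dominated-sum-neg : ∀ r x t → ℤ.∣ r ∣ < t → x ℤ.≤ ℤ.- + t → r ℤ.+ x ℤ.< 0ℤ
dominated-sum-neg r x t ∣r∣<t x≤-t = subst (r ℤ.+ x ℤ.<_) (ℤₚ.+-inverseʳ r)
  (ℤₚ.+-monoʳ-< r (ℤₚ.≤-<-trans x≤-t (ℤₚ.<-≤-trans (ℤₚ.neg-mono-< (ℤ.+<+ ∣r∣<t)) (ℤₚ.neg-mono-≤ (i≤+∣i∣ r)))))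

t≤pos*t : ∀ p t → + t ℤ.≤ +[1+ p ] ℤ.* + t
t≤pos*t p t = subst (+ t ℤ.≤_) (ℤₚ.pos-* (suc p) t) (ℤ.+≤+ (ℕₚ.m≤m+n t (p ℕ.* t)))

neg*t≤-t : ∀ p t → -[1+ p ] ℤ.* + t ℤ.≤ ℤ.- + t
neg*t≤-t p t = subst (ℤ._≤ ℤ.- + t) (ℤₚ.neg-distribˡ-* +[1+ p ] (+ t)) (ℤₚ.neg-mono-≤ (t≤pos*t p t))

lastNonzero : ∀ (c : ℕ → ℤ) k → (∀ {i} → InRange k i → c i ≡ 0ℤ) ⊎
              (∃ λ j → suc j ≤ k × c (suc j) ≢ 0ℤ × (∀ i → suc j < i → i ≤ k → c i ≡ 0ℤ))
lastNonzero c zero = inj₁ λ (1≤i , i≤0) → ⊥-elim (ℕₚ.<-irrefl refl (ℕₚ.≤-trans 1≤i i≤0))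
lastNonzero c (suc k) with c (suc k) ℤ.≟ 0ℤ
... | no c≢0 = inj₂ (k , ℕₚ.≤-refl , c≢0 , λ i k<i i≤k → ⊥-elim (ℕₚ.<-irrefl refl (ℕₚ.<-≤-trans k<i i≤k)))
... | yes c≡0 with lastNonzero c k
...   | inj₁ allZero = inj₁ λ {i} (1≤i , i≤1+k) → case (ℕₚ.m≤n⇒m<n∨m≡n i≤1+k) 1≤i
  where
  case : ∀ {i} → i < suc k ⊎ i ≡ suc k → 1 ≤ i → c i ≡ 0ℤ
  case (inj₁ (s≤s i≤k)) 1≤i = allZero (1≤i , i≤k)
  case (inj₂ refl) _ = c≡0
...   | inj₂ (j , j<k , c≢0 , above) = inj₂ (j , ℕₚ.m≤n⇒m≤1+n j<k , c≢0 , λ i j<i i≤1+k → case (ℕₚ.m≤n⇒m<n∨m≡n i≤1+k) j<i)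
  where
  case : ∀ {i} → i < suc k ⊎ i ≡ suc k → suc j < i → c i ≡ 0ℤ
  case (inj₁ (s≤s i≤k)) j<i = above _ j<i i≤k
  case (inj₂ refl) _ = c≡0

expN-suc : ∀ a b n → expN (suc a) b n ≡ n ℕ.* expN a b n
expN-suc a b n = ℕₚ.*-assoc n (n ℕ.^ a) (b ℕ.^ n)

expN-pos : ∀ a b n → 1 ≤ n → 1 ≤ b → 0 < expN a b n
expN-pos a b n 1≤n 1≤b = ℕₚ.*-mono-≤ (one≤^ n a 1≤n) (one≤^ b n 1≤b)
  where
  one≤^ : ∀ x k → 1 ≤ x → 1 ≤ x ℕ.^ k
  one≤^ x zero _ = s≤s z≤n
  one≤^ x (suc k) 1≤x = ℕₚ.*-mono-≤ 1≤x (one≤^ x k 1≤x)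

expN-zeroBase : ∀ a n → 1 ≤ n → expN a 0 n ≡ 0
expN-zeroBase a (suc n) _ = ℕₚ.*-zeroʳ (suc n ℕ.^ a)

expN-monoˡ : ∀ {a a′} b n → 1 ≤ n → a ≤ a′ → expN a b n ≤ expN a′ b n
expN-monoˡ b (suc n) _ a≤a′ = ℕₚ.*-monoˡ-≤ (b ℕ.^ suc n) (ℕₚ.^-monoʳ-≤ (suc n) a≤a′)

-- The fields of Thresholds are what n ≥ max{2M, C} provides: the paper's M_j and N_j.
module LeadingTerm (ℓ : ℕ) (base deg : ℕ → ℕ) (coeff : ℕ → ℤ) (M : ℕ)
  (increasing : ∀ j → 1 ≤ j → suc j ≤ ℓ → (base (suc j) , deg (suc j)) >lex (base j , deg j))
  (coeff≤M : ∀ i → 1 ≤ i → i < ℓ → ℤ.∣ coeff i ∣ ≤ M) where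

  term : ℕ → ℕ → ℕ
  term n i = expN (deg i) (base i) n

  summand : ℕ → ℕ → ℤ
  summand n i = coeff i ℤ.* + term n i

  value : ℕ → ℤ
  value n = sumℤ (summand n) ℓ

  record Thresholds (n : ℕ) : Set where
    field
      1≤n : 1 ≤ n
      2M≤n : M ℕ.+ M ≤ n
      M-threshold : ∀ j → 2 ≤ j → j ≤ ℓ → base j ≢ base (j ∸ 1) → n ℕ.* term n (j ∸ 1) < term n j
      N-threshold₁ : ∀ j → 3 ≤ j → j ≤ ℓ → (j ∸ 2) ℕ.* term n (j ∸ 2) < term n (j ∸ 1)
      N-threshold₂ : ∀ j i → 3 ≤ j → j ≤ ℓ → 1 ≤ i → i ≤ j ∸ 3 → term n i < term n (j ∸ 2)

  base-zero-below : ∀ j → j ≤ ℓ → base j ≡ 0 → ∀ {i} → InRange j i → base i ≡ 0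
  base-zero-below zero _ _ (1≤i , i≤0) = ⊥-elim (ℕₚ.<-irrefl refl (ℕₚ.≤-trans 1≤i i≤0))
  base-zero-below (suc j) j<ℓ base≡0 (1≤i , i≤1+j) with ℕₚ.m≤n⇒m<n∨m≡n i≤1+j
  ... | inj₂ refl = base≡0
  ... | inj₁ (s≤s i≤j) = base-zero-below j (ℕₚ.≤-trans (ℕₚ.n≤1+n j) j<ℓ) base-j≡0 (1≤i , i≤j)
    where
    base-j≡0 : base j ≡ 0
    base-j≡0 with increasing j (ℕₚ.≤-trans 1≤i i≤j) j<ℓ
    ... | inj₁ base-j<base-1+j = ⊥-elim (ℕₚ.n≮0 (subst (base j <_) base≡0 base-j<base-1+j))
    ... | inj₂ (same , _) = trans (sym same) base≡0

  term-zero-below : ∀ {n} j → 1 ≤ n → j ≤ ℓ → base j ≡ 0 → ∀ {i} → InRange j i → term n i ≡ 0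
  term-zero-below {n} j 1≤n j≤ℓ base≡0 {i} i∈ rewrite base-zero-below j j≤ℓ base≡0 i∈ = expN-zeroBase (deg i) n 1≤n

  module _ {n : ℕ} (th : Thresholds n) where
    open Thresholds th

    term-pos : ∀ i → 1 ≤ base i → 0 < term n i
    term-pos i 1≤base = expN-pos (deg i) (base i) n 1≤n 1≤base

    prefix<next : ∀ j → suc (suc j) ≤ ℓ → 1 ≤ base (suc j) → sumℕ (term n) j < term n (suc j)
    prefix<next zero _ 1≤base = term-pos 1 1≤base
    prefix<next (suc j) j+2<ℓ _ = begin-strict
      sumℕ (term n) (suc j)        ≤⟨ sumℕ-bounded (term n) (suc j) (term n (suc j)) below ⟩
      suc j ℕ.* term n (suc j)     <⟨ N-threshold₁ (3 ℕ.+ j) (s≤s (s≤s (s≤s z≤n))) j+2<ℓ ⟩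
      term n (suc (suc j))         ∎
      where
      open ℕₚ.≤-Reasoning
      below : ∀ {i} → InRange (suc j) i → term n i ≤ term n (suc j)
      below {i} (1≤i , i≤1+j) with ℕₚ.m≤n⇒m<n∨m≡n i≤1+j
      ... | inj₂ refl = ℕₚ.≤-refl
      ... | inj₁ (s≤s i≤j) = ℕₚ.<⇒≤ (N-threshold₂ (3 ℕ.+ j) i (s≤s (s≤s (s≤s z≤n))) j+2<ℓ 1≤i i≤j)

    M*2t≤n*t : ∀ t → M ℕ.* (t ℕ.+ t) ≤ n ℕ.* t
    M*2t≤n*t t = begin
      M ℕ.* (t ℕ.+ t)       ≡⟨ ℕₚ.*-distribˡ-+ M t t ⟩
      M ℕ.* t ℕ.+ M ℕ.* t   ≡⟨ sym (ℕₚ.*-distribʳ-+ t M M) ⟩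
      (M ℕ.+ M) ℕ.* t       ≤⟨ ℕₚ.*-monoˡ-≤ t 2M≤n ⟩
      n ℕ.* t               ∎
      where open ℕₚ.≤-Reasoning

    same-base⇒n*term≤next : ∀ j → suc (suc j) ≤ ℓ → base (2 ℕ.+ j) ≡ base (suc j) →
                            n ℕ.* term n (suc j) ≤ term n (2 ℕ.+ j)
    same-base⇒n*term≤next j j+2≤ℓ same-base = begin
      n ℕ.* term n (suc j)                       ≡⟨ sym (expN-suc (deg (suc j)) (base (suc j)) n) ⟩
      expN (suc (deg (suc j))) (base (suc j)) n  ≤⟨ expN-monoˡ (base (suc j)) n 1≤n deg-increases ⟩
      expN (deg (2 ℕ.+ j)) (base (suc j)) n      ≡⟨ cong (λ b → expN (deg (2 ℕ.+ j)) b n) (sym same-base) ⟩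
      term n (2 ℕ.+ j)                           ∎
      where
      open ℕₚ.≤-Reasoning
      deg-increases : deg (suc j) < deg (2 ℕ.+ j)
      deg-increases with increasing (suc j) (s≤s z≤n) j+2≤ℓ
      ... | inj₁ base< = ⊥-elim (ℕₚ.<-irrefl (sym same-base) base<)
      ... | inj₂ (_ , deg<) = deg<

    -- Either base j+2 > base j+1, and the M-threshold absorbs the factor 2M ≤ n, or the bases agree
    -- and deg j+2 > deg j+1 supplies that factor n.
    M*prefix<next : ∀ j → suc j ≤ ℓ → 1 ≤ base (suc j) → M ℕ.* sumℕ (term n) j < term n (suc j)
    M*prefix<next zero _ 1≤base = subst (_< term n 1) (sym (ℕₚ.*-zeroʳ M)) (term-pos 1 1≤base)
    M*prefix<next (suc j) j+2≤ℓ 1≤base with base (suc j) ℕ.≟ 0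
    ... | yes base≡0 = subst (λ s → M ℕ.* s < term n (2 ℕ.+ j))
                         (sym (sumℕ-zero (term n) (suc j) (term-zero-below (suc j) 1≤n (ℕₚ.≤-trans (ℕₚ.n≤1+n _) j+2≤ℓ) base≡0)))
                         (subst (_< term n (2 ℕ.+ j)) (sym (ℕₚ.*-zeroʳ M)) (term-pos _ 1≤base))
    ... | no base≢0 = goal (base (2 ℕ.+ j) ℕ.≟ base (suc j))
      where
      open ℕₚ.≤-Reasoning
      t₁ t₂ S : ℕ
      t₁ = term n (suc j)
      t₂ = term n (2 ℕ.+ j)
      S = sumℕ (term n) (suc j)
      S<2t₁ : S < t₁ ℕ.+ t₁
      S<2t₁ = ℕₚ.+-monoˡ-< t₁ (prefix<next j j+2≤ℓ (ℕₚ.n≢0⇒n>0 base≢0))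
      goal : Dec (base (2 ℕ.+ j) ≡ base (suc j)) → M ℕ.* S < t₂
      goal (no base-differs) = begin-strict
        M ℕ.* S             ≤⟨ ℕₚ.*-monoʳ-≤ M (ℕₚ.<⇒≤ S<2t₁) ⟩
        M ℕ.* (t₁ ℕ.+ t₁)   ≤⟨ M*2t≤n*t t₁ ⟩
        n ℕ.* t₁            <⟨ M-threshold (2 ℕ.+ j) (s≤s (s≤s z≤n)) j+2≤ℓ base-differs ⟩
        t₂                  ∎
      goal (yes same-base) with M ℕ.≟ 0
      ... | yes refl = term-pos _ 1≤base
      ... | no M≢0 = begin-strict
        M ℕ.* S             <⟨ ℕₚ.*-monoʳ-< M {{ℕ.≢-nonZero M≢0}} S<2t₁ ⟩
        M ℕ.* (t₁ ℕ.+ t₁)   ≤⟨ M*2t≤n*t t₁ ⟩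
        n ℕ.* t₁            ≤⟨ same-base⇒n*term≤next j j+2≤ℓ same-base ⟩
        t₂                  ∎

    remainder<leading : ∀ j → suc j ≤ ℓ → 1 ≤ base (suc j) → ℤ.∣ sumℤ (summand n) j ∣ < term n (suc j)
    remainder<leading j j<ℓ 1≤base = begin-strict
      ℤ.∣ sumℤ (summand n) j ∣                    ≤⟨ ∣sumℤ∣≤sumℕ∣∣ coeff (term n) j ⟩
      sumℕ (λ i → ℤ.∣ coeff i ∣ ℕ.* term n i) j   ≤⟨ sumℕ-mono _ _ j coeff≤M′ ⟩
      sumℕ (λ i → M ℕ.* term n i) j               ≡⟨ sumℕ-*ˡ M (term n) j ⟩
      M ℕ.* sumℕ (term n) j                        <⟨ M*prefix<next j j<ℓ 1≤base ⟩
      term n (suc j)                               ∎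
      where
      open ℕₚ.≤-Reasoning
      coeff≤M′ : ∀ {i} → InRange j i → ℤ.∣ coeff i ∣ ℕ.* term n i ≤ M ℕ.* term n i
      coeff≤M′ {i} (1≤i , i≤j) = ℕₚ.*-monoˡ-≤ (term n i) (coeff≤M i 1≤i (ℕₚ.≤-<-trans i≤j j<ℓ))

  value-split : ∀ n j → suc j ≤ ℓ → (∀ i → suc j < i → i ≤ ℓ → coeff i ≡ 0ℤ) →
                value n ≡ sumℤ (summand n) j ℤ.+ summand n (suc j)
  value-split n j j<ℓ zeroAbove =
    sumℤ-truncate (summand n) (suc j) ℓ j<ℓ λ i j<i i≤ℓ → cong (ℤ._* + term n i) (zeroAbove i j<i i≤ℓ)

  -- The sign of the value is the sign of its last nonzero coefficient, whose term is positive.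
  LeadingPositive : Set
  LeadingPositive = ∃ λ j → suc j ≤ ℓ × (∀ i → suc j < i → i ≤ ℓ → coeff i ≡ 0ℤ) × 1 ≤ base (suc j) × 0ℤ ℤ.< coeff (suc j)

  value-pos⇒leading-pos : ∀ {n} → Thresholds n → 0ℤ ℤ.< value n → LeadingPositive
  value-pos⇒leading-pos {n} th 0<value with lastNonzero coeff ℓ
  ... | inj₁ allZero = ⊥-elim (ℤₚ.<-irrefl (sym (sumℤ-zero _ ℓ λ i∈ → cong (ℤ._* + _) (allZero i∈))) 0<value)
  ... | inj₂ (j , j<ℓ , c≢0 , zeroAbove) with base (suc j) ℕ.≟ 0
  ...   | yes base≡0 = ⊥-elim (ℤₚ.<-irrefl (sym value≡0) 0<value)
    where
    open ≡-Reasoning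
    t≡0 : ∀ {i} → InRange (suc j) i → term n i ≡ 0
    t≡0 = term-zero-below (suc j) (Thresholds.1≤n th) j<ℓ base≡0
    summand≡0 : ∀ {i} → InRange (suc j) i → summand n i ≡ 0ℤ
    summand≡0 {i} i∈ = trans (cong (λ t → coeff i ℤ.* + t) (t≡0 i∈)) (ℤₚ.*-zeroʳ (coeff i))
    value≡0 : value n ≡ 0ℤ
    value≡0 = begin
      value n                                           ≡⟨ value-split n j j<ℓ zeroAbove ⟩
      sumℤ (summand n) j ℤ.+ summand n (suc j)          ≡⟨ cong₂ ℤ._+_ (sumℤ-zero _ j (summand≡0 ∘ InRange-suc))
                                                                       (summand≡0 (InRange-top j)) ⟩
      0ℤ                                                ∎
  ...   | no base≢0 = j , j<ℓ , zeroAbove , ℕₚ.n≢0⇒n>0 base≢0 , sign (coeff (suc j)) c≢0 refl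
    where
    sign : ∀ c → c ≢ 0ℤ → c ≡ coeff (suc j) → 0ℤ ℤ.< c
    sign (+ zero) c≢0 _ = ⊥-elim (c≢0 refl)
    sign +[1+ _ ] _ _ = ℤ.+<+ (s≤s z≤n)
    sign -[1+ p ] _ c≡ = ⊥-elim (ℤₚ.<-asym 0<value (subst (ℤ._< 0ℤ) (sym (value-split n j j<ℓ zeroAbove))
      (dominated-sum-neg (sumℤ (summand n) j) (summand n (suc j)) (term n (suc j))
        (remainder<leading th j j<ℓ (ℕₚ.n≢0⇒n>0 base≢0))
        (subst (λ c → c ℤ.* + term n (suc j) ℤ.≤ ℤ.- + term n (suc j)) c≡ (neg*t≤-t p _)))))

  leading-pos⇒value-pos : ∀ {n} → Thresholds n → LeadingPositive → 0ℤ ℤ.< value n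
  leading-pos⇒value-pos {n} th (j , j<ℓ , zeroAbove , 1≤base , 0<c) = subst (0ℤ ℤ.<_) (sym (value-split n j j<ℓ zeroAbove))
    (dominated-sum-pos (sumℤ (summand n) j) (summand n (suc j)) (term n (suc j))
      (remainder<leading th j j<ℓ 1≤base) (t≤c*t (coeff (suc j)) 0<c))
    where
    t≤c*t : ∀ c → 0ℤ ℤ.< c → + term n (suc j) ℤ.≤ c ℤ.* + term n (suc j)
    t≤c*t +[1+ p ] _ = t≤pos*t p _
    t≤c*t (+ zero) (ℤ.+<+ ())

  value-pos-stable : ∀ {n n′} → Thresholds n → Thresholds n′ → 0ℤ ℤ.< value n → 0ℤ ℤ.< value n′
  value-pos-stable th th′ = leading-pos⇒value-pos th′ ∘ value-pos⇒leading-pos th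

↥-toℚ : ∀ z → ↥ (toℚ z) ≡ z
↥-toℚ z = trans (sym (ℤₚ.*-identityʳ (↥ (toℚ z)))) (trans (cong (↥ (toℚ z) ℤ.*_) (sym (ℤ.gcd-zeroʳ z))) (ℚₚ.↥-/ z 1))

↧-toℚ : ∀ z → ↧ (toℚ z) ≡ + 1
↧-toℚ z = trans (sym (ℤₚ.*-identityʳ (↧ (toℚ z)))) (trans (cong (↧ (toℚ z) ℤ.*_) (sym (ℤ.gcd-zeroʳ z))) (ℚₚ.↧-/ z 1))

toℚ-injective : ∀ {x y} → toℚ x ≡ toℚ y → x ≡ y
toℚ-injective {x} {y} eq = trans (sym (↥-toℚ x)) (trans (cong ↥_ eq) (↥-toℚ y))

toℚᵘ-toℚ : ∀ z → toℚᵘ (toℚ z) ℚᵘ.≃ mkℚᵘ z 0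
toℚᵘ-toℚ z = *≡* (cong₂ ℤ._*_ (trans (ℚₚ.↥ᵘ-toℚᵘ (toℚ z)) (↥-toℚ z)) (sym (trans (ℚₚ.↧ᵘ-toℚᵘ (toℚ z)) (↧-toℚ z))))

-- Equalities of rationals are checked on their unnormalised images, where z/1 is just mkℚᵘ z 0.
toℚ-homo-+ : ∀ x y → toℚ (x ℤ.+ y) ≡ toℚ x ℚ.+ toℚ y
toℚ-homo-+ x y = ℚₚ.toℚᵘ-injective (begin
  toℚᵘ (toℚ (x ℤ.+ y))               ≈⟨ toℚᵘ-toℚ (x ℤ.+ y) ⟩
  mkℚᵘ (x ℤ.+ y) 0                   ≈⟨ *≡* (cong (ℤ._* + 1) (cong₂ ℤ._+_ (sym (ℤₚ.*-identityʳ x)) (sym (ℤₚ.*-identityʳ y)))) ⟩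
  mkℚᵘ x 0 ℚᵘ.+ mkℚᵘ y 0             ≈⟨ ℚᵘₚ.+-cong (ℚᵘₚ.≃-sym (toℚᵘ-toℚ x)) (ℚᵘₚ.≃-sym (toℚᵘ-toℚ y)) ⟩
  toℚᵘ (toℚ x) ℚᵘ.+ toℚᵘ (toℚ y)     ≈⟨ ℚᵘₚ.≃-sym (ℚₚ.toℚᵘ-homo-+ (toℚ x) (toℚ y)) ⟩
  toℚᵘ (toℚ x ℚ.+ toℚ y)             ∎)
  where open ℚᵘₚ.≃-Reasoning

toℚ-homo-* : ∀ x y → toℚ (x ℤ.* y) ≡ toℚ x ℚ.* toℚ y
toℚ-homo-* x y = ℚₚ.toℚᵘ-injective (begin
  toℚᵘ (toℚ (x ℤ.* y))               ≈⟨ toℚᵘ-toℚ (x ℤ.* y) ⟩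
  mkℚᵘ x 0 ℚᵘ.* mkℚᵘ y 0             ≈⟨ ℚᵘₚ.*-cong (ℚᵘₚ.≃-sym (toℚᵘ-toℚ x)) (ℚᵘₚ.≃-sym (toℚᵘ-toℚ y)) ⟩
  toℚᵘ (toℚ x) ℚᵘ.* toℚᵘ (toℚ y)     ≈⟨ ℚᵘₚ.≃-sym (ℚₚ.toℚᵘ-homo-* (toℚ x) (toℚ y)) ⟩
  toℚᵘ (toℚ x ℚ.* toℚ y)             ∎)
  where open ℚᵘₚ.≃-Reasoning

toℚ-homo‿- : ∀ x → toℚ (ℤ.- x) ≡ ℚ.- toℚ x
toℚ-homo‿- x = ℚₚ.toℚᵘ-injective (begin
  toℚᵘ (toℚ (ℤ.- x))                 ≈⟨ toℚᵘ-toℚ (ℤ.- x) ⟩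
  ℚᵘ.- mkℚᵘ x 0                      ≈⟨ ℚᵘₚ.-‿cong (ℚᵘₚ.≃-sym (toℚᵘ-toℚ x)) ⟩
  ℚᵘ.- toℚᵘ (toℚ x)                  ≈⟨ ℚᵘₚ.≃-sym (ℚₚ.toℚᵘ-homo‿- (toℚ x)) ⟩
  toℚᵘ (ℚ.- toℚ x)                   ∎)
  where open ℚᵘₚ.≃-Reasoning

toℚ-↥-cleared : ∀ (L : ℕ) (q : ℚ) → ↧ₙ q ∣ L → toℚ (↥ (toℚ (+ L) ℚ.* q)) ≡ toℚ (+ L) ℚ.* q
toℚ-↥-cleared L q@(mkℚ m d-1 _) (divides k refl) =
  trans (cong (toℚ ∘ ↥_) L*q≡k*m) (trans (cong toℚ (↥-toℚ (+ k ℤ.* m))) (sym L*q≡k*m))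
  where
  open ℚᵘₚ.≃-Reasoning
  L*q≡k*m : toℚ (+ L) ℚ.* q ≡ toℚ (+ k ℤ.* m)
  L*q≡k*m = ℚₚ.toℚᵘ-injective (begin
    toℚᵘ (toℚ (+ L) ℚ.* q)              ≈⟨ ℚₚ.toℚᵘ-homo-* (toℚ (+ L)) q ⟩
    toℚᵘ (toℚ (+ L)) ℚᵘ.* mkℚᵘ m d-1     ≈⟨ ℚᵘₚ.*-congʳ (toℚᵘ-toℚ (+ L)) ⟩
    mkℚᵘ (+ L) 0 ℚᵘ.* mkℚᵘ m d-1         ≈⟨ *≡* (k*d*m≡k*m*d k (suc d-1) m) ⟩
    mkℚᵘ (+ k ℤ.* m) 0                   ≈⟨ ℚᵘₚ.≃-sym (toℚᵘ-toℚ (+ k ℤ.* m)) ⟩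
    toℚᵘ (toℚ (+ k ℤ.* m))               ∎)
    where
    k*d*m≡k*m*d : ∀ k d m → (+ (k ℕ.* d) ℤ.* m) ℤ.* + 1 ≡ (+ k ℤ.* m) ℤ.* + (d ℕ.+ 0)
    k*d*m≡k*m*d k d m =
      trans (ℤₚ.*-identityʳ _) (trans (cong (ℤ._* m) (ℤₚ.pos-* k d)) (trans (xy∙z≈xz∙y (+ k) (+ d) m)
            (cong (λ d′ → + k ℤ.* m ℤ.* + d′) (sym (ℕₚ.+-identityʳ d)))))
      where open CommSemigroupProperties ℤₚ.*-commutativeSemigroup using (xy∙z≈xz∙y)

module ℤSum = MonoidSum ℤₚ.+-0-commutativeMonoid
module ℚSum = MonoidSum ℚₚ.+-0-commutativeMonoid

termValueℚ : ∀ {d} → Vec ℤ d → ℕ → Key d × ℚ → ℚ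
termValueℚ e n ((m , a , b) , c) = c ℚ.* toℚ (evalMono e m) ℚ.* toℚ (+ expN a b n)

termValueℤ : ∀ {d} → Vec ℤ d → ℕ → Key d × ℤ → ℤ
termValueℤ e n ((m , a , b) , c) = c ℤ.* evalMono e m ℤ.* + expN a b n

*-^-distrib : ∀ b b′ n → (b ℕ.* b′) ℕ.^ n ≡ b ℕ.^ n ℕ.* b′ ℕ.^ n
*-^-distrib b b′ zero = refl
*-^-distrib b b′ (suc n) = trans (cong ((b ℕ.* b′) ℕ.*_) (*-^-distrib b b′ n)) (interchange b b′ (b ℕ.^ n) (b′ ℕ.^ n))
  where open CommSemigroupProperties ℕₚ.*-commutativeSemigroup using (interchange)

expN-* : ∀ a a′ b b′ n → expN (a ℕ.+ a′) (b ℕ.* b′) n ≡ expN a b n ℕ.* expN a′ b′ n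
expN-* a a′ b b′ n = begin
  n ℕ.^ (a ℕ.+ a′) ℕ.* (b ℕ.* b′) ℕ.^ n                       ≡⟨ cong₂ ℕ._*_ (ℕₚ.^-distribˡ-+-* n a a′) (*-^-distrib b b′ n) ⟩
  n ℕ.^ a ℕ.* n ℕ.^ a′ ℕ.* (b ℕ.^ n ℕ.* b′ ℕ.^ n)              ≡⟨ interchange (n ℕ.^ a) (n ℕ.^ a′) (b ℕ.^ n) (b′ ℕ.^ n) ⟩
  n ℕ.^ a ℕ.* b ℕ.^ n ℕ.* (n ℕ.^ a′ ℕ.* b′ ℕ.^ n)              ∎
  where
  open ≡-Reasoning
  open CommSemigroupProperties ℕₚ.*-commutativeSemigroup using (interchange)

evalMono-zipWith-+ : ∀ {d} (e : Vec ℤ d) m m′ → evalMono e (Vec.zipWith ℕ._+_ m m′) ≡ evalMono e m ℤ.* evalMono e m′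
evalMono-zipWith-+ [] [] [] = refl
evalMono-zipWith-+ (x ∷ e) (k ∷ m) (k′ ∷ m′) = begin
  x ℤ.^ (k ℕ.+ k′) ℤ.* evalMono e (Vec.zipWith ℕ._+_ m m′)
    ≡⟨ cong₂ ℤ._*_ (ℤₚ.^-distribˡ-+-* x k k′) (evalMono-zipWith-+ e m m′) ⟩
  x ℤ.^ k ℤ.* x ℤ.^ k′ ℤ.* (evalMono e m ℤ.* evalMono e m′)
    ≡⟨ interchange (x ℤ.^ k) (x ℤ.^ k′) (evalMono e m) (evalMono e m′) ⟩
  x ℤ.^ k ℤ.* evalMono e m ℤ.* (x ℤ.^ k′ ℤ.* evalMono e m′)     ∎
  where
  open ≡-Reasoning
  open CommSemigroupProperties ℤₚ.*-commutativeSemigroup using (interchange)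

evalMono-zeroMono : ∀ {d} (e : Vec ℤ d) → evalMono e zeroMono ≡ 1ℤ
evalMono-zeroMono [] = refl
evalMono-zeroMono (x ∷ e) = trans (ℤₚ.*-identityˡ _) (evalMono-zeroMono e)

lookupVar-∈ : ∀ {d} {A : Set} (dflt : A) (xs : Vec Var d) (as : Vec A d) {v} → v ∈ toList xs →
              ∃ λ i → lookupVar dflt xs as v ≡ Vec.lookup as i × Vec.lookup xs i ≡ v
lookupVar-∈ dflt (x ∷ xs) (a ∷ as) {v} v∈ with v ℕ.≡ᵇ x in v≡ᵇx
... | true = Fin.zero , refl , sym (ℕₚ.≡ᵇ⇒≡ v x (subst IsTrue (sym v≡ᵇx) tt))
... | false with v∈
...   | here v≡x = ⊥-elim (subst IsTrue v≡ᵇx (ℕₚ.≡⇒≡ᵇ v x v≡x))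
...   | there v∈xs with i , eq , xᵢ≡v ← lookupVar-∈ dflt xs as v∈xs = Fin.suc i , eq , xᵢ≡v

∣-lcms : ∀ {x} l → x ∈ l → x ∣ foldr lcm 1 l
∣-lcms (y ∷ l) (here refl) = m∣lcm[m,n] y _
∣-lcms (y ∷ l) (there x∈) = ∣-trans (∣-lcms l x∈) (n∣lcm[m,n] y _)

lcms-nonzero : ∀ l → All (_≢ 0) l → foldr lcm 1 l ≢ 0
lcms-nonzero [] [] ()
lcms-nonzero (y ∷ l) (y≢0 ∷ l≢0) lcm≡0
  with ℕₚ.m*n≡0⇒m≡0∨n≡0 y (trans (sym (gcd*lcm y (foldr lcm 1 l))) (trans (cong (gcd y _ ℕ.*_) lcm≡0) (ℕₚ.*-zeroʳ (gcd y (foldr lcm 1 l)))))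
... | inj₁ y≡0 = y≢0 y≡0
... | inj₂ rest≡0 = lcms-nonzero l l≢0 rest≡0

<⇒0<− : ∀ {a b} → a ℤ.< b → 0ℤ ℤ.< b ℤ.- a
<⇒0<− {a} {b} a<b = subst (ℤ._< b ℤ.- a) (ℤₚ.+-inverseʳ a) (ℤₚ.+-monoˡ-< (ℤ.- a) a<b)

0<−⇒< : ∀ {a b} → 0ℤ ℤ.< b ℤ.- a → a ℤ.< b
0<−⇒< {a} {b} 0<b-a = subst₂ ℤ._<_ (ℤₚ.+-identityˡ a) b-a+a≡b (ℤₚ.+-monoˡ-< a 0<b-a)
  where
  b-a+a≡b : b ℤ.- a ℤ.+ a ≡ b
  b-a+a≡b = trans (ℤₚ.+-assoc b (ℤ.- a) a) (trans (cong (ℤ._+_ b) (ℤₚ.+-inverseˡ a)) (ℤₚ.+-identityʳ b))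

<⇔0<scaled− : ∀ a b L → L ≢ 0 → a ℤ.< b ⇔ 0ℤ ℤ.< + L ℤ.* (b ℤ.- a)
<⇔0<scaled− a b zero L≢0 = ⊥-elim (L≢0 refl)
<⇔0<scaled− a b (suc l) _ = mk⇔
  (λ a<b → subst (ℤ._< L*[b-a]) (ℤₚ.*-zeroʳ +[1+ l ]) (ℤₚ.*-monoˡ-<-pos +[1+ l ] (<⇒0<− a<b)))
  (λ 0<L*[b-a] → 0<−⇒< (ℤₚ.*-cancelˡ-<-nonNeg (+ suc l) (subst (ℤ._< L*[b-a]) (sym (ℤₚ.*-zeroʳ +[1+ l ])) 0<L*[b-a])))
  where L*[b-a] = +[1+ l ] ℤ.* (b ℤ.- a)

module TermAlgebra {d : ℕ} (e : Vec ℤ d) (n : ℕ) where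

  evalQ-++ : ∀ ts us → evalQ e n (ts ++ us) ≡ evalQ e n ts ℚ.+ evalQ e n us
  evalQ-++ = ℚSum.sumBy-++ (termValueℚ e n)

  termValueℚ-mulT : ∀ t u → termValueℚ e n (mulT t u) ≡ termValueℚ e n t ℚ.* termValueℚ e n u
  termValueℚ-mulT ((m , a , b) , c) ((m′ , a′ , b′) , c′) = begin
    c ℚ.* c′ ℚ.* toℚ (evalMono e (Vec.zipWith ℕ._+_ m m′)) ℚ.* toℚ (+ expN (a ℕ.+ a′) (b ℕ.* b′) n)
      ≡⟨ cong₂ (λ x y → c ℚ.* c′ ℚ.* x ℚ.* y) monos exps ⟩
    c ℚ.* c′ ℚ.* (toℚ (evalMono e m) ℚ.* toℚ (evalMono e m′)) ℚ.* (toℚ (+ expN a b n) ℚ.* toℚ (+ expN a′ b′ n))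
      ≡⟨ cong (ℚ._* _) (interchange c c′ (toℚ (evalMono e m)) (toℚ (evalMono e m′))) ⟩
    c ℚ.* toℚ (evalMono e m) ℚ.* (c′ ℚ.* toℚ (evalMono e m′)) ℚ.* (toℚ (+ expN a b n) ℚ.* toℚ (+ expN a′ b′ n))
      ≡⟨ interchange (c ℚ.* toℚ (evalMono e m)) (c′ ℚ.* toℚ (evalMono e m′)) (toℚ (+ expN a b n)) (toℚ (+ expN a′ b′ n)) ⟩
    termValueℚ e n ((m , a , b) , c) ℚ.* termValueℚ e n ((m′ , a′ , b′) , c′)
      ∎
    where
    open ≡-Reasoning
    open CommSemigroupProperties (CommutativeMonoid.commutativeSemigroup ℚₚ.*-1-commutativeMonoid) using (interchange)
    monos : toℚ (evalMono e (Vec.zipWith ℕ._+_ m m′)) ≡ toℚ (evalMono e m) ℚ.* toℚ (evalMono e m′)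
    monos = trans (cong toℚ (evalMono-zipWith-+ e m m′)) (toℚ-homo-* (evalMono e m) (evalMono e m′))
    exps : toℚ (+ expN (a ℕ.+ a′) (b ℕ.* b′) n) ≡ toℚ (+ expN a b n) ℚ.* toℚ (+ expN a′ b′ n)
    exps = trans (cong (toℚ ∘ +_) (expN-* a a′ b b′ n))
                 (trans (cong toℚ (ℤₚ.pos-* (expN a b n) (expN a′ b′ n))) (toℚ-homo-* (+ expN a b n) (+ expN a′ b′ n)))

  evalQ-map-mulT : ∀ t us → evalQ e n (map (mulT t) us) ≡ termValueℚ e n t ℚ.* evalQ e n us
  evalQ-map-mulT t [] = sym (ℚₚ.*-zeroʳ (termValueℚ e n t))
  evalQ-map-mulT t (u ∷ us) = trans (cong₂ ℚ._+_ (termValueℚ-mulT t u) (evalQ-map-mulT t us))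
                                    (sym (ℚₚ.*-distribˡ-+ (termValueℚ e n t) _ _))

  evalQ-product : ∀ ts us → evalQ e n (concatMap (λ t → map (mulT t) us) ts) ≡ evalQ e n ts ℚ.* evalQ e n us
  evalQ-product [] us = sym (ℚₚ.*-zeroˡ (evalQ e n us))
  evalQ-product (t ∷ ts) us = begin
    evalQ e n (map (mulT t) us ++ concatMap (λ t → map (mulT t) us) ts)
      ≡⟨ evalQ-++ (map (mulT t) us) _ ⟩
    evalQ e n (map (mulT t) us) ℚ.+ evalQ e n (concatMap (λ t → map (mulT t) us) ts)
      ≡⟨ cong₂ ℚ._+_ (evalQ-map-mulT t us) (evalQ-product ts us) ⟩
    termValueℚ e n t ℚ.* evalQ e n us ℚ.+ evalQ e n ts ℚ.* evalQ e n us
      ≡⟨ sym (ℚₚ.*-distribʳ-+ (evalQ e n us) (termValueℚ e n t) (evalQ e n ts)) ⟩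
    evalQ e n (t ∷ ts) ℚ.* evalQ e n us
      ∎
    where open ≡-Reasoning

  evalQ-negate : ∀ ts → evalQ e n (map (λ t → (proj₁ t , ℚ.- proj₂ t)) ts) ≡ ℚ.- evalQ e n ts
  evalQ-negate [] = refl
  evalQ-negate (((m , a , b) , c) ∷ ts) = trans (cong₂ ℚ._+_ negate-term (evalQ-negate ts))
                                                (sym (ℚₚ.neg-distrib-+ (termValueℚ e n ((m , a , b) , c)) _))
    where
    negate-term : termValueℚ e n ((m , a , b) , ℚ.- c) ≡ ℚ.- termValueℚ e n ((m , a , b) , c)
    negate-term = trans (cong (ℚ._* _) (sym (ℚₚ.neg-distribˡ-* c _))) (sym (ℚₚ.neg-distribˡ-* (c ℚ.* _) _))

  evalQ-normQ : ∀ ts → evalQ e n (normQ ts) ≡ evalQ e n ts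
  evalQ-normQ ts = trans (ℚSum.sumBy-filterᵇ (termValueℚ e n) _ zero-dropped (mergeAll keyDec ℚ._+_ ts))
                         (ℚSum.sumBy-mergeAll keyDec ℚ._+_ (termValueℚ e n) +-distrib ts)
    where
    +-distrib : ∀ k c c′ → termValueℚ e n (k , c ℚ.+ c′) ≡ termValueℚ e n (k , c) ℚ.+ termValueℚ e n (k , c′)
    +-distrib (m , a , b) c c′ = trans (cong (ℚ._* toℚ (+ expN a b n)) (ℚₚ.*-distribʳ-+ (toℚ (evalMono e m)) c c′))
                                       (ℚₚ.*-distribʳ-+ (toℚ (+ expN a b n)) (c ℚ.* toℚ (evalMono e m)) (c′ ℚ.* toℚ (evalMono e m)))
    zero-dropped : ∀ t → not (does (proj₂ t ℚₚ.≟ 0ℚ)) ≡ false → termValueℚ e n t ≡ 0ℚ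
    zero-dropped ((m , a , b) , c) _ with c ℚₚ.≟ 0ℚ
    zero-dropped ((m , a , b) , c) _ | yes refl =
      trans (cong (ℚ._* toℚ (+ expN a b n)) (ℚₚ.*-zeroˡ (toℚ (evalMono e m)))) (ℚₚ.*-zeroˡ (toℚ (+ expN a b n)))
    zero-dropped ((m , a , b) , c) () | no _

module ClosedFormExpansion {d : ℕ} (L : Loop d) (cf : ClosedForm d) (n₀ : ℕ)
  (closed : ∀ i σ n → n₀ ≤ n →
     evalQ (Vec.map σ (xs L)) n (Vec.lookup cf i) ≡ toℚ (⟦ iterP (toList (xs L)) (η L) n (var (Vec.lookup (xs L) i)) ⟧ σ))
  (σ : State) {n : ℕ} (n₀≤n : n₀ ≤ n) where

  private
    S : List Var
    S = toList (xs L)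
    e : Vec ℤ d
    e = Vec.map σ (xs L)
    σₙ : State
    σₙ = updateⁿ S (η L) n σ
  open TermAlgebra e n

  expand-correct : ∀ p → PolyOver S p → evalQ e n (expand (xs L) cf p) ≡ toℚ (⟦ p ⟧ σₙ)
  expand-correct (var v) v∈S with i , lookup≡ , refl ← lookupVar-∈ [] (xs L) cf v∈S rewrite lookup≡ =
    trans (closed i σ n n₀≤n) (cong toℚ (⟦iterP⟧ S (η L) n (var (Vec.lookup (xs L) i)) σ))
  expand-correct (con z) _ = begin
    toℚ z ℚ.* toℚ (evalMono e zeroMono) ℚ.* toℚ (+ expN 0 1 n) ℚ.+ 0ℚ
      ≡⟨ ℚₚ.+-identityʳ _ ⟩
    toℚ z ℚ.* toℚ (evalMono e zeroMono) ℚ.* toℚ (+ expN 0 1 n)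
      ≡⟨ cong₂ (λ x y → toℚ z ℚ.* toℚ x ℚ.* toℚ (+ y)) (evalMono-zeroMono e)
               (trans (ℕₚ.+-identityʳ (1 ℕ.^ n)) (ℕₚ.^-zeroˡ n)) ⟩
    toℚ z ℚ.* toℚ 1ℤ ℚ.* toℚ 1ℤ
      ≡⟨ trans (ℚₚ.*-identityʳ _) (ℚₚ.*-identityʳ _) ⟩
    toℚ z
      ∎
    where open ≡-Reasoning
  expand-correct (p ⊕ q) (p∈ , q∈) =
    trans (evalQ-++ (expand (xs L) cf p) _)
          (trans (cong₂ ℚ._+_ (expand-correct p p∈) (expand-correct q q∈)) (sym (toℚ-homo-+ (⟦ p ⟧ σₙ) _)))
  expand-correct (p ⊗ q) (p∈ , q∈) =
    trans (evalQ-product (expand (xs L) cf p) _)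
          (trans (cong₂ ℚ._*_ (expand-correct p p∈) (expand-correct q q∈)) (sym (toℚ-homo-* (⟦ p ⟧ σₙ) _)))
  expand-correct (⊝ p) p∈ =
    trans (evalQ-negate (expand (xs L) cf p)) (trans (cong ℚ.-_ (expand-correct p p∈)) (sym (toℚ-homo‿- (⟦ p ⟧ σₙ))))

  scale : ℕ → Key d × ℚ → Key d × ℤ
  scale l (k , c) = k , ↥ (toℚ (+ l) ℚ.* c)

  evalZ-scale : ∀ l ts → (∀ {t} → t ∈ ts → ↧ₙ proj₂ t ∣ l) →
                toℚ (evalZ e n (map (scale l) ts)) ≡ toℚ (+ l) ℚ.* evalQ e n ts
  evalZ-scale l [] _ = sym (ℚₚ.*-zeroʳ (toℚ (+ l)))
  evalZ-scale l (((m , a , b) , c) ∷ ts) ∣l = begin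
    toℚ (c′ ℤ.* x ℤ.* y ℤ.+ evalZ e n (map (scale l) ts))
      ≡⟨ toℚ-homo-+ (c′ ℤ.* x ℤ.* y) _ ⟩
    toℚ (c′ ℤ.* x ℤ.* y) ℚ.+ toℚ (evalZ e n (map (scale l) ts))
      ≡⟨ cong₂ ℚ._+_ head (evalZ-scale l ts (∣l ∘ there)) ⟩
    toℚ (+ l) ℚ.* termValueℚ e n ((m , a , b) , c) ℚ.+ toℚ (+ l) ℚ.* evalQ e n ts
      ≡⟨ sym (ℚₚ.*-distribˡ-+ (toℚ (+ l)) _ _) ⟩
    toℚ (+ l) ℚ.* evalQ e n (((m , a , b) , c) ∷ ts)
      ∎
    where
    open ≡-Reasoning
    c′ x y : ℤ
    c′ = ↥ (toℚ (+ l) ℚ.* c)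
    x = evalMono e m
    y = + expN a b n
    head : toℚ (c′ ℤ.* x ℤ.* y) ≡ toℚ (+ l) ℚ.* termValueℚ e n ((m , a , b) , c)
    head = begin
      toℚ (c′ ℤ.* x ℤ.* y)                        ≡⟨ trans (toℚ-homo-* (c′ ℤ.* x) y) (cong (ℚ._* toℚ y) (toℚ-homo-* c′ x)) ⟩
      toℚ c′ ℚ.* toℚ x ℚ.* toℚ y                  ≡⟨ cong (λ z → z ℚ.* toℚ x ℚ.* toℚ y) (toℚ-↥-cleared l c (∣l (here refl))) ⟩
      toℚ (+ l) ℚ.* c ℚ.* toℚ x ℚ.* toℚ y          ≡⟨ cong (ℚ._* toℚ y) (ℚₚ.*-assoc (toℚ (+ l)) c (toℚ x)) ⟩
      toℚ (+ l) ℚ.* (c ℚ.* toℚ x) ℚ.* toℚ y        ≡⟨ ℚₚ.*-assoc (toℚ (+ l)) (c ℚ.* toℚ x) (toℚ y) ⟩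
      toℚ (+ l) ℚ.* termValueℚ e n ((m , a , b) , c) ∎

  npe-value : ∀ s₁ s₂ → PolyOver S s₁ → PolyOver S s₂ →
              ∃ λ l → l ≢ 0 × evalZ e n (npe (xs L) cf (s₁ , s₂)) ≡ + l ℤ.* (⟦ s₂ ⟧ σₙ ℤ.- ⟦ s₁ ⟧ σₙ)
  npe-value s₁ s₂ s₁∈ s₂∈ = l , lcms-nonzero dens (denominators-nonzero N) , trans (cong (evalZ e n) npe≡) scaled
    where
    N : List (Key d × ℚ)
    N = normQ (expand (xs L) cf (s₂ ⊕ (⊝ s₁)))
    dens : List ℕ
    dens = map (↧ₙ_ ∘ proj₂) N
    l : ℕ
    l = foldr lcm 1 dens
    npe≡ : npe (xs L) cf (s₁ , s₂) ≡ map (scale l) N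
    npe≡ = refl
    denominators-nonzero : ∀ ts → All (_≢ 0) (map (↧ₙ_ ∘ proj₂) ts)
    denominators-nonzero [] = []
    denominators-nonzero ((_ , mkℚ _ _ _) ∷ ts) = (λ ()) ∷ denominators-nonzero ts
    evalN : evalQ e n N ≡ toℚ (⟦ s₂ ⟧ σₙ ℤ.- ⟦ s₁ ⟧ σₙ)
    evalN = trans (evalQ-normQ (expand (xs L) cf (s₂ ⊕ (⊝ s₁)))) (expand-correct (s₂ ⊕ (⊝ s₁)) (s₂∈ , s₁∈))
    scaled : evalZ e n (map (scale l) N) ≡ + l ℤ.* (⟦ s₂ ⟧ σₙ ℤ.- ⟦ s₁ ⟧ σₙ)
    scaled = toℚ-injective (begin
      toℚ (evalZ e n (map (scale l) N))         ≡⟨ evalZ-scale l N (λ t∈ → ∣-lcms dens (∈-map⁺ (↧ₙ_ ∘ proj₂) t∈)) ⟩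
      toℚ (+ l) ℚ.* evalQ e n N                 ≡⟨ cong (toℚ (+ l) ℚ.*_) evalN ⟩
      toℚ (+ l) ℚ.* toℚ (⟦ s₂ ⟧ σₙ ℤ.- ⟦ s₁ ⟧ σₙ) ≡⟨ sym (toℚ-homo-* (+ l) _) ⟩
      toℚ (+ l ℤ.* (⟦ s₂ ⟧ σₙ ℤ.- ⟦ s₁ ⟧ σₙ))    ∎)
      where open ≡-Reasoning

  atom⇔npe-pos : ∀ s₁ s₂ → PolyOver S s₁ → PolyOver S s₂ →
                 AtomHolds σₙ (s₁ , s₂) ⇔ 0ℤ ℤ.< evalZ e n (npe (xs L) cf (s₁ , s₂))
  atom⇔npe-pos s₁ s₂ s₁∈ s₂∈ = from-value (npe-value s₁ s₂ s₁∈ s₂∈)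
    where
    from-value : (∃ λ l → l ≢ 0 × evalZ e n (npe (xs L) cf (s₁ , s₂)) ≡ + l ℤ.* (⟦ s₂ ⟧ σₙ ℤ.- ⟦ s₁ ⟧ σₙ)) →
                 AtomHolds σₙ (s₁ , s₂) ⇔ 0ℤ ℤ.< evalZ e n (npe (xs L) cf (s₁ , s₂))
    from-value (l , l≢0 , npe≡) = subst (AtomHolds σₙ (s₁ , s₂) ⇔_) (cong (0ℤ ℤ.<_) (sym npe≡))
                                        (<⇔0<scaled− (⟦ s₁ ⟧ σₙ) (⟦ s₂ ⟧ σₙ) l l≢0)

>lex-trans : ∀ {p q r} → q >lex p → r >lex q → r >lex p
>lex-trans (inj₁ b<b′) (inj₁ b′<b″) = inj₁ (ℕₚ.<-trans b<b′ b′<b″)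
>lex-trans (inj₁ b<b′) (inj₂ (refl , _)) = inj₁ b<b′
>lex-trans (inj₂ (refl , _)) (inj₁ b′<b″) = inj₁ b′<b″
>lex-trans (inj₂ (refl , a<a′)) (inj₂ (refl , a′<a″)) = inj₂ (refl , ℕₚ.<-trans a<a′ a′<a″)

>lex-trichotomous : ∀ p q → p ≢ q → q >lex p ⊎ p >lex q
>lex-trichotomous (b , a) (b′ , a′) p≢q with ℕ.<-cmp b b′ | ℕ.<-cmp a a′
... | tri< b<b′ _ _ | _ = inj₁ (inj₁ b<b′)
... | tri> _ _ b′<b | _ = inj₂ (inj₁ b′<b)
... | tri≈ _ refl _ | tri< a<a′ _ _ = inj₁ (inj₂ (refl , a<a′))
... | tri≈ _ refl _ | tri≈ _ refl _ = ⊥-elim (p≢q refl)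
... | tri≈ _ refl _ | tri> _ _ a′<a = inj₂ (inj₂ (refl , a′<a))

<lexᵇ-sound : ∀ p q → IsTrue (p <lexᵇ q) → q >lex p
<lexᵇ-sound (b , a) (b′ , a′) holds with Equivalence.to T-∨ holds
... | inj₁ b<ᵇb′ = inj₁ (ℕₚ.<ᵇ⇒< b b′ b<ᵇb′)
... | inj₂ both with b≡ᵇb′ , a<ᵇa′ ← Equivalence.to T-∧ both =
  inj₂ (sym (ℕₚ.≡ᵇ⇒≡ b b′ b≡ᵇb′) , ℕₚ.<ᵇ⇒< a a′ a<ᵇa′)

<lexᵇ-complete : ∀ p q → q >lex p → IsTrue (p <lexᵇ q)
<lexᵇ-complete (b , a) (b′ , a′) (inj₁ b<b′) = Equivalence.from T-∨ (inj₁ (ℕₚ.<⇒<ᵇ b<b′))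
<lexᵇ-complete (b , a) (b′ , a′) (inj₂ (refl , a<a′)) =
  Equivalence.from T-∨ (inj₂ (Equivalence.from T-∧ (ℕₚ.≡⇒≡ᵇ b b refl , ℕₚ.<⇒<ᵇ a<a′)))

module Grouping {d : ℕ} (L : Loop d) where
  open StabDefs L

  _⊏_ : Group → Group → Set
  g ⊏ h = proj₁ h >lex proj₁ g

  sortGroups : List Group → List Group
  sortGroups = foldr insertSorted []

  ∈-insertSorted⁻ : ∀ g hs {x} → x ∈ insertSorted g hs → x ≡ g ⊎ x ∈ hs
  ∈-insertSorted⁻ g [] (here refl) = inj₁ refl
  ∈-insertSorted⁻ g (h ∷ hs) x∈ with proj₁ g <lexᵇ proj₁ h
  ∈-insertSorted⁻ g (h ∷ hs) (here refl) | true = inj₁ refl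
  ∈-insertSorted⁻ g (h ∷ hs) (there x∈) | true = inj₂ x∈
  ∈-insertSorted⁻ g (h ∷ hs) (here refl) | false = inj₂ (here refl)
  ∈-insertSorted⁻ g (h ∷ hs) (there x∈) | false with ∈-insertSorted⁻ g hs x∈
  ... | inj₁ x≡g = inj₁ x≡g
  ... | inj₂ x∈hs = inj₂ (there x∈hs)

  insertSorted-sorted : ∀ g hs → AllPairs _⊏_ hs → (∀ {h} → h ∈ hs → proj₁ g ≢ proj₁ h) →
                        AllPairs _⊏_ (insertSorted g hs)
  insertSorted-sorted g [] _ _ = [] ∷ []
  insertSorted-sorted g (h ∷ hs) (h⊏hs ∷ sorted) distinct with proj₁ g <lexᵇ proj₁ h in g<ᵇh
  ... | true = (g⊏h ∷ All.map (>lex-trans g⊏h) h⊏hs) ∷ h⊏hs ∷ sorted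
    where g⊏h = <lexᵇ-sound (proj₁ g) (proj₁ h) (subst IsTrue (sym g<ᵇh) tt)
  ... | false = All.tabulate h⊏ ∷ insertSorted-sorted g hs sorted (distinct ∘ there)
    where
    h⊏g : h ⊏ g
    h⊏g with >lex-trichotomous (proj₁ g) (proj₁ h) (distinct (here refl))
    ... | inj₁ g⊏h = ⊥-elim (subst IsTrue g<ᵇh (<lexᵇ-complete (proj₁ g) (proj₁ h) g⊏h))
    ... | inj₂ h⊏g = h⊏g
    h⊏ : ∀ {x} → x ∈ insertSorted g hs → h ⊏ x
    h⊏ x∈ with ∈-insertSorted⁻ g hs x∈
    ... | inj₁ refl = h⊏g
    ... | inj₂ x∈hs = All.lookup h⊏hs x∈hs

  ∈-sortGroups⁻ : ∀ gs {x} → x ∈ sortGroups gs → x ∈ gs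
  ∈-sortGroups⁻ (g ∷ gs) x∈ with ∈-insertSorted⁻ g (sortGroups gs) x∈
  ... | inj₁ refl = here refl
  ... | inj₂ x∈sorted = there (∈-sortGroups⁻ gs x∈sorted)

  sortGroups-sorted : ∀ gs → Unique (keys gs) → AllPairs _⊏_ (sortGroups gs)
  sortGroups-sorted [] _ = []
  sortGroups-sorted (g ∷ gs) (g∉ ∷ uniq) =
    insertSorted-sorted g _ (sortGroups-sorted gs uniq) λ h∈ → All.lookup g∉ (∈-map⁺ proj₁ (∈-sortGroups⁻ gs h∈))

  sumBy-insertSorted : ∀ (f : Group → ℤ) g hs → ℤSum.sumBy f (insertSorted g hs) ≡ f g ℤ.+ ℤSum.sumBy f hs
  sumBy-insertSorted f g [] = refl
  sumBy-insertSorted f g (h ∷ hs) with proj₁ g <lexᵇ proj₁ h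
  ... | true = refl
  ... | false = trans (cong (ℤ._+_ (f h)) (sumBy-insertSorted f g hs)) (x∙yz≈y∙xz (f h) (f g) _)
    where open CommSemigroupProperties ℤₚ.+-commutativeSemigroup using (x∙yz≈y∙xz)

  sumBy-sortGroups : ∀ (f : Group → ℤ) gs → ℤSum.sumBy f (sortGroups gs) ≡ ℤSum.sumBy f gs
  sumBy-sortGroups f [] = refl
  sumBy-sortGroups f (g ∷ gs) = trans (sumBy-insertSorted f g (sortGroups gs)) (cong (ℤ._+_ (f g)) (sumBy-sortGroups f gs))

  key-increasing : ∀ gs → AllPairs _⊏_ gs → ∀ j → 1 ≤ j → suc j ≤ length gs → key gs (suc j) >lex key gs j
  key-increasing (g ∷ h ∷ _) ((g⊏h ∷ _) ∷ _) 1 _ _ = g⊏h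
  key-increasing (g ∷ gs) (_ ∷ sorted) (suc (suc j)) _ (s≤s j<len) = key-increasing gs sorted (suc j) (s≤s z≤n) j<len

  polyAt : List Group → ℕ → List (Mono d × ℤ)
  polyAt [] _ = []
  polyAt (g ∷ gs) zero = []
  polyAt (g ∷ gs) (suc zero) = proj₂ g
  polyAt (g ∷ gs) (suc (suc i)) = polyAt gs (suc i)

  polyAt-∈ : ∀ gs i → 1 ≤ i → i ≤ length gs → ∃ λ g → g ∈ gs × polyAt gs i ≡ proj₂ g
  polyAt-∈ (g ∷ gs) 1 _ _ = g , here refl , refl
  polyAt-∈ (g ∷ gs) (suc (suc i)) _ (s≤s i<len) with g′ , g′∈ , eq ← polyAt-∈ gs (suc i) (s≤s z≤n) i<len =
    g′ , there g′∈ , eq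

  evalPoly : Vec ℤ d → List (Mono d × ℤ) → ℤ
  evalPoly e = ℤSum.sumBy (λ (m , c) → c ℤ.* evalMono e m)

  groupValue : Vec ℤ d → ℕ → Group → ℤ
  groupValue e n ((b , a) , P) = evalPoly e P ℤ.* + expN a b n

  indexedGroupValue : Vec ℤ d → ℕ → List Group → ℕ → ℤ
  indexedGroupValue e n gs i = evalPoly e (polyAt gs i) ℤ.* + expN (proj₂ (key gs i)) (proj₁ (key gs i)) n

  sumBy-groupValue≡sumℤ : ∀ e n gs → ℤSum.sumBy (groupValue e n) gs ≡ sumℤ (indexedGroupValue e n gs) (length gs)
  sumBy-groupValue≡sumℤ e n [] = refl
  sumBy-groupValue≡sumℤ e n (g ∷ gs) =
    trans (cong (ℤ._+_ (groupValue e n g)) (trans (sumBy-groupValue≡sumℤ e n gs) (shifted (length gs))))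
          (sym (sumℤ-shift (indexedGroupValue e n (g ∷ gs)) (length gs)))
    where
    shifted : ∀ k → sumℤ (indexedGroupValue e n gs) k ≡ sumℤ (indexedGroupValue e n (g ∷ gs) ∘ suc) k
    shifted zero = refl
    shifted (suc k) = cong (ℤ._+ indexedGroupValue e n gs (suc k)) (shifted k)

  singletonGroup : Key d × ℤ → Group
  singletonGroup ((m , a , b) , c) = (b , a) , [ (m , c) ]

  _≟ᵍ_ : DecidableEquality (ℕ × ℕ)
  _≟ᵍ_ = ×ₚ.≡-dec ℕ._≟_ ℕ._≟_

  module _ (e : Vec ℤ d) (n : ℕ) where

    evalZ-normZ : ∀ ts → evalZ e n (normZ ts) ≡ evalZ e n ts
    evalZ-normZ ts = trans (ℤSum.sumBy-filterᵇ (termValueℤ e n) _ zero-dropped (mergeAll keyDec ℤ._+_ ts))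
                           (ℤSum.sumBy-mergeAll keyDec ℤ._+_ (termValueℤ e n) +-distrib ts)
      where
      +-distrib : ∀ k c c′ → termValueℤ e n (k , c ℤ.+ c′) ≡ termValueℤ e n (k , c) ℤ.+ termValueℤ e n (k , c′)
      +-distrib (m , a , b) c c′ = trans (cong (ℤ._* + expN a b n) (ℤₚ.*-distribʳ-+ (evalMono e m) c c′))
                                         (ℤₚ.*-distribʳ-+ (+ expN a b n) (c ℤ.* evalMono e m) (c′ ℤ.* evalMono e m))
      zero-dropped : ∀ t → not (does (proj₂ t ℤ.≟ 0ℤ)) ≡ false → termValueℤ e n t ≡ 0ℤ
      zero-dropped ((m , a , b) , c) _ with c ℤ.≟ 0ℤ
      zero-dropped ((m , a , b) , c) _ | yes refl = refl
      zero-dropped ((m , a , b) , c) () | no _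

    evalZ≡sum-groups : ∀ ts → evalZ e n ts ≡ ℤSum.sumBy (groupValue e n) (groups ts)
    evalZ≡sum-groups ts = begin
      evalZ e n ts                                                       ≡⟨ sym (evalZ-normZ ts) ⟩
      ℤSum.sumBy (termValueℤ e n) (normZ ts)                            ≡⟨ ℤSum.sumBy-cong singleton-value (normZ ts) ⟩
      ℤSum.sumBy (groupValue e n ∘ singletonGroup) (normZ ts)           ≡⟨ sym (ℤSum.sumBy-map (groupValue e n) singletonGroup (normZ ts)) ⟩
      ℤSum.sumBy (groupValue e n) singletons                            ≡⟨ sym (ℤSum.sumBy-mergeAll _≟ᵍ_ _++_ (groupValue e n) ++-distrib singletons) ⟩
      ℤSum.sumBy (groupValue e n) (mergeAll _≟ᵍ_ _++_ singletons)       ≡⟨ sym (sumBy-sortGroups (groupValue e n) (mergeAll _≟ᵍ_ _++_ singletons)) ⟩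
      ℤSum.sumBy (groupValue e n) (groups ts)                           ∎
      where
      open ≡-Reasoning
      singletons : List Group
      singletons = map singletonGroup (normZ ts)
      singleton-value : ∀ t → termValueℤ e n t ≡ groupValue e n (singletonGroup t)
      singleton-value ((m , a , b) , c) = cong (ℤ._* + expN a b n) (sym (ℤₚ.+-identityʳ (c ℤ.* evalMono e m)))
      ++-distrib : ∀ k P Q → groupValue e n (k , P ++ Q) ≡ groupValue e n (k , P) ℤ.+ groupValue e n (k , Q)
      ++-distrib (b , a) P Q = trans (cong (ℤ._* + expN a b n) (ℤSum.sumBy-++ (λ (m , c) → c ℤ.* evalMono e m) P Q))
                                     (ℤₚ.*-distribʳ-+ (+ expN a b n) (evalPoly e P) (evalPoly e Q))

  groups-sorted : ∀ ts → AllPairs _⊏_ (groups ts)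
  groups-sorted ts = sortGroups-sorted _ (mergeAll-unique _≟ᵍ_ _++_ (map singletonGroup (normZ ts)))

  GroupFrom : List (Key d × ℤ) → Group → Set
  GroupFrom J ((b , a) , P) = Unique (keys P) × (∀ {mc} → mc ∈ P → (proj₁ mc , a , b) ∈ keys J)

  insertMerge-groupFrom : ∀ m a b c J gs → (∀ {g} → g ∈ gs → GroupFrom J g) → (m , a , b) ∉ keys J →
                          ∀ {g} → g ∈ insertMerge _≟ᵍ_ _++_ ((b , a) , [ (m , c) ]) gs → GroupFrom (((m , a , b) , c) ∷ J) g
  insertMerge-groupFrom m a b c J [] _ _ (here refl) = [] ∷ [] , λ { (here refl) → here refl }
  insertMerge-groupFrom m a b c J (((b′ , a′) , P) ∷ gs) from m∉J g∈ with (b , a) ≟ᵍ (b′ , a′)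
  insertMerge-groupFrom m a b c J (((b , a) , P) ∷ gs) from m∉J (here refl) | yes refl =
    All.tabulate m≢ ∷ proj₁ (from (here refl)) , λ { (here refl) → here refl ; (there mc∈) → there (proj₂ (from (here refl)) mc∈) }
    where
    m≢ : ∀ {m′} → m′ ∈ keys P → m ≢ m′
    m≢ m′∈ refl with mc , mc∈ , refl ← ∈-map⁻ proj₁ m′∈ = m∉J (proj₂ (from (here refl)) mc∈)
  insertMerge-groupFrom m a b c J (((b , a) , P) ∷ gs) from m∉J (there g∈) | yes refl =
    let (uniq , sub) = from (there g∈) in uniq , there ∘ sub
  insertMerge-groupFrom m a b c J (g₁ ∷ gs) from m∉J (here refl) | no _ =
    let (uniq , sub) = from (here refl) in uniq , there ∘ sub
  insertMerge-groupFrom m a b c J (g₁ ∷ gs) from m∉J (there g∈) | no _ =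
    insertMerge-groupFrom m a b c J gs (from ∘ there) m∉J g∈

  mergeAll-groupFrom : ∀ J → Unique (keys J) → ∀ {g} → g ∈ mergeAll _≟ᵍ_ _++_ (map singletonGroup J) → GroupFrom J g
  mergeAll-groupFrom (((m , a , b) , c) ∷ J) (t∉ ∷ uniq) =
    insertMerge-groupFrom m a b c J _ (mergeAll-groupFrom J uniq) (λ t∈ → All.lookup t∉ t∈ refl)

  groups-monoUnique : ∀ ts {g} → g ∈ groups ts → Unique (keys (proj₂ g))
  groups-monoUnique ts {(b , a) , P} g∈ =
    proj₁ (mergeAll-groupFrom (normZ ts) normZ-unique (∈-sortGroups⁻ _ g∈))
    where
    normZ-unique : Unique (keys (normZ ts))
    normZ-unique = filterᵇ-unique-keys _ (mergeAll keyDec ℤ._+_ ts) (mergeAll-unique keyDec ℤ._+_ ts)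

module Replacement {d : ℕ} (L : Loop d) where
  open StabDefs L

  tagWith : (ts : List (Key d × ℤ)) → (Fin (length ts) → Tag) → List ((Key d × ℤ) × Tag)
  tagWith ts τ = tabulate (λ k → (List.lookup ts k , τ k))

  replaced-untagged : ∀ ts τ → ¬ Any (Tagged ∘ proj₂) (tagWith ts τ) → map replaced (tagWith ts τ) ≡ ts
  replaced-untagged [] τ _ = refl
  replaced-untagged (t ∷ ts) τ noTag with τ Fin.zero
  ... | none = cong (t ∷_) (replaced-untagged ts (τ ∘ Fin.suc) (noTag ∘ there))
  ... | inΔ _ _ = ⊥-elim (noTag (here tt))
  ... | inΓ _ _ = ⊥-elim (noTag (here tt))

  module _ (mt : MTFun) {σ : State} (ψ'σ : ⟦ ψ' ⟧F σ) (n : ℕ) where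
    private e = Vec.map σ (xs L)

    ThresholdPassed : Item → Set
    ThresholdPassed it = ItemOK mt it × itemVal mt it ≤ n

    -- A Δ-term has a positive and a Γ-term a non-positive coefficient, so moving to the dominating,
    -- resp. dominated, exponential can only increase its value.
    replaced-≥ : ∀ t → TagValid t → (∀ {it} → it ∈ Ditem t → ThresholdPassed it) →
                 termValueℤ e n (proj₁ t) ℤ.≤ termValueℤ e n (replaced t)
    replaced-≥ (_ , none) _ _ = ℤₚ.≤-refl
    replaced-≥ (((m , a , b) , c) , inΔ i j) (pos , _) passed with (dominates , _) , passed-n ← passed (here refl) =
      ℤₚ.*-monoˡ-≤-nonNeg (c ℤ.* evalMono e m) {{ℤ.nonNegative (ℤₚ.<⇒≤ (pos σ ψ'σ))}}
        (ℤ.+≤+ (ℕₚ.<⇒≤ (subst (ℕ._< expN i j n) (ℕₚ.*-identityˡ (expN a b n)) (dominates n passed-n))))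
    replaced-≥ (((m , a , b) , c) , inΓ i j) (nonpos , _) passed with (dominates , _) , passed-n ← passed (here refl) =
      ℤₚ.*-monoˡ-≤-nonPos (c ℤ.* evalMono e m) {{ℤ.nonPositive (nonpos σ ψ'σ)}}
        (ℤ.+≤+ (ℕₚ.<⇒≤ (subst (ℕ._< expN a b n) (ℕₚ.*-identityˡ (expN i j n)) (dominates n passed-n))))

    evalZ-replaced-≥ : ∀ ts τ → All TagValid (tagWith ts τ) →
                       (∀ {t} → t ∈ tagWith ts τ → ∀ {it} → it ∈ Ditem t → ThresholdPassed it) →
                       evalZ e n ts ℤ.≤ evalZ e n (map replaced (tagWith ts τ))
    evalZ-replaced-≥ [] τ _ _ = ℤₚ.≤-refl
    evalZ-replaced-≥ (t ∷ ts) τ (valid ∷ valids) passed =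
      ℤₚ.+-mono-≤ (replaced-≥ (t , τ Fin.zero) valid (passed (here refl)))
                  (evalZ-replaced-≥ ts (τ ∘ Fin.suc) valids (passed ∘ there))

∣i^k∣≡∣i∣^k : ∀ i k → ℤ.∣ i ℤ.^ k ∣ ≡ ℤ.∣ i ∣ ℕ.^ k
∣i^k∣≡∣i∣^k i zero = refl
∣i^k∣≡∣i∣^k i (suc k) = trans (ℤₚ.abs-* i (i ℤ.^ k)) (cong (ℤ.∣ i ∣ ℕ.*_) (∣i^k∣≡∣i∣^k i k))

evalB-power : ∀ ρ x k → evalB ρ (foldr _⊠_ (nat 1) (replicate k (bvar x))) ≡ fin (ρ x ℕ.^ k)
evalB-power ρ x zero = refl
evalB-power ρ x (suc k) rewrite evalB-power ρ x k = refl

module BoundEvaluation {d : ℕ} (L : Loop d) where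
  open StabDefs L
  open Grouping L using (evalPoly; polyAt)

  monoBound-eval : ∀ σ {k} (ys : Vec Var k) ms → evalB ∣ σ ∣ₛ (monoBound ys ms) ≡ fin ℤ.∣ evalMono (Vec.map σ ys) ms ∣
  monoBound-eval σ [] [] = refl
  monoBound-eval σ (y ∷ ys) (m ∷ ms) rewrite evalB-power ∣ σ ∣ₛ y m | monoBound-eval σ ys ms =
    cong fin (sym (trans (ℤₚ.abs-* (σ y ℤ.^ m) _) (cong (ℕ._* _) (∣i^k∣≡∣i∣^k (σ y) m))))

  absCoeff : Mono d × ℤ → Mono d × ℕ
  absCoeff (m , c) = m , ℤ.∣ c ∣

  supCoeffs : List (List (Mono d × ℤ)) → List (Mono d × ℕ)
  supCoeffs ps = mergeAll (Vecₚ.≡-dec ℕ._≟_) _⊔_ (map absCoeff (concat ps))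

  module _ (σ : State) where
    private
      e : Vec ℤ d
      e = Vec.map σ (xs L)
      weight : Mono d → ℕ
      weight m = ℤ.∣ evalMono e m ∣

    supBound-eval : ∀ ps → evalB ∣ σ ∣ₛ (supBound ps) ≡ fin (weightedSum weight (supCoeffs ps))
    supBound-eval ps = go (supCoeffs ps)
      where
      go : ∀ mcs → evalB ∣ σ ∣ₛ (foldr (λ t acc → (nat (proj₂ t) ⊠ monoBound (xs L) (proj₁ t)) ⊞ acc) (nat 0) mcs)
                   ≡ fin (weightedSum weight mcs)
      go [] = refl
      go ((m , c) ∷ mcs) rewrite monoBound-eval σ (xs L) m | go mcs = refl

    ∣evalPoly∣≤ : ∀ P → ℤ.∣ evalPoly e P ∣ ≤ weightedSum weight (map absCoeff P)
    ∣evalPoly∣≤ [] = z≤n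
    ∣evalPoly∣≤ ((m , c) ∷ P) = ℕₚ.≤-trans (ℤₚ.∣i+j∣≤∣i∣+∣j∣ (c ℤ.* evalMono e m) (evalPoly e P))
      (ℕₚ.+-mono-≤ (ℕₚ.≤-reflexive (ℤₚ.abs-* c (evalMono e m))) (∣evalPoly∣≤ P))

    ∣evalPoly∣≤supBound : ∀ ps P → Unique (keys P) → (∀ {t} → t ∈ P → t ∈ concat ps) →
                          ℤ.∣ evalPoly e P ∣ ≤ weightedSum weight (supCoeffs ps)
    ∣evalPoly∣≤supBound ps P uniq P⊆ = ℕₚ.≤-trans (∣evalPoly∣≤ P)
      (weightedSum-dominated weight (map absCoeff P) (supCoeffs ps) (subst Unique (sym (keys-absCoeff P)) uniq) dominated)
      where
      keys-absCoeff : ∀ P → keys (map absCoeff P) ≡ keys P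
      keys-absCoeff [] = refl
      keys-absCoeff (t ∷ P) = cong (proj₁ t ∷_) (keys-absCoeff P)
      dominated : ∀ {t} → t ∈ map absCoeff P → DominatedIn (supCoeffs ps) t
      dominated t∈ with t₀ , t₀∈ , refl ← ∈-map⁻ absCoeff t∈ =
        mergeAll-⊔-dominates (Vecₚ.≡-dec ℕ._≟_) (map absCoeff (concat ps)) (∈-map⁺ absCoeff (P⊆ t₀∈))

  polyAt-∈-init : ∀ gs i → 1 ≤ i → i < length gs → polyAt gs i ∈ map proj₂ (take (length gs ∸ 1) gs)
  polyAt-∈-init (g ∷ []) 1 _ (s≤s ())
  polyAt-∈-init (g ∷ h ∷ gs) 1 _ _ = here refl
  polyAt-∈-init (g ∷ h ∷ gs) (suc (suc i)) _ (s≤s i<len) = there (polyAt-∈-init (h ∷ gs) (suc i) (s≤s z≤n) i<len)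

  polyAt-⊆-Pol : ∀ cf τ α i → 1 ≤ i → i < length (groups (npeBar cf τ α)) →
                 ∀ {t} → t ∈ polyAt (groups (npeBar cf τ α)) i → t ∈ concat (Pol cf τ)
  polyAt-⊆-Pol cf τ α i 1≤i i<len t∈ =
    ∈-concat⁺′ t∈ (∈-concatMap⁺ _ (Any.map (λ { refl → polyAt-∈-init _ i 1≤i i<len }) (∈-tabulate⁺ α)))

-- Stabilization of the guard

≤-foldr-⊔ : ∀ {ns : List ℕ} {n} → n ∈ ns → n ≤ foldr _⊔_ 0 ns
≤-foldr-⊔ (here refl) = ℕₚ.m≤m⊔n _ _
≤-foldr-⊔ {m ∷ _} (there n∈) = ℕₚ.≤-trans (≤-foldr-⊔ n∈) (ℕₚ.m≤n⊔m m _)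

m∸2<n∸1 : ∀ {m n} → 2 ≤ m → m ≤ n → m ∸ 2 < n ∸ 1
m∸2<n∸1 {suc zero} (s≤s ()) _
m∸2<n∸1 {suc (suc m)} {suc n} _ (s≤s m+1≤n) = m+1≤n

orbit : ∀ {d} → Loop d → State → ℕ → State
orbit L σ n = updateⁿ (toList (xs L)) (η L) n σ

GuardedBelow : ∀ {d} → Loop d → State → ℕ → Set
GuardedBelow L σ m = ∀ j → j < m → ⟦ φ L ⟧F (orbit L σ j)

GuardAlways : ∀ {d} → Loop d → State → Set
GuardAlways L σ = ∀ j → ⟦ φ L ⟧F (orbit L σ j)

Tagged? : ∀ tag → Dec (Tagged tag)
Tagged? none = no λ ()
Tagged? (inΔ _ _) = yes tt
Tagged? (inΓ _ _) = yes tt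

module Stabilization {d : ℕ} (L : Loop d) (n₀ : ℕ) (cf : ClosedForm d) (closed : IsClosedForm L cf n₀)
  (τ : StabDefs.Tags L cf) (valid : ∀ α → All (StabDefs.TagValid L) (StabDefs.tagged L cf τ α))
  (eventuallyNonPos : StabDefs.EventuallyNonPos L cf τ) (mt : StabDefs.MTFun L)
  (thresholds : All (ItemOK mt) (StabDefs.allItems L n₀ cf τ))
  (φ-over : FormulaOver (toList (xs L)) (φ L)) (ψ-over : FormulaOver (toList (xs L)) (ψ L)) (σ : State) where

  open StabDefs L
  open Grouping L
  open Replacement L using (replaced-untagged; evalZ-replaced-≥)
  open BoundEvaluation L using (supCoeffs; supBound-eval; ∣evalPoly∣≤supBound; polyAt-⊆-Pol)

  private
    S : List Var
    S = toList (xs L)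
    e : Vec ℤ d
    e = Vec.map σ (xs L)
    σ_ : ℕ → State
    σ_ = orbit L σ

  M : ℕ
  M = weightedSum (λ m → ℤ.∣ evalMono e m ∣) (supCoeffs (Pol cf τ))

  K : ℕ
  K = foldr _⊔_ 0 (map (itemVal mt) (allItems n₀ cf τ))

  B : ℕ
  B = 2 ℕ.* M ℕ.+ K

  evalB-sth : evalB ∣ σ ∣ₛ (sthOf n₀ cf τ mt) ≡ fin B
  evalB-sth = cong (λ x → (fin 2 *∞ x) +∞ fin K) (supBound-eval σ (Pol cf τ))

  K≤B : K ≤ B
  K≤B = ℕₚ.m≤n+m K (2 ℕ.* M)

  passed : ∀ {it n} → it ∈ allItems n₀ cf τ → B ≤ n → ItemOK mt it × itemVal mt it ≤ n
  passed it∈ B≤n = All.lookup thresholds it∈ , ℕₚ.≤-trans (≤-foldr-⊔ (∈-map⁺ (itemVal mt) it∈)) (ℕₚ.≤-trans K≤B B≤n)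

  n₀≤B : n₀ ≤ B
  n₀≤B = proj₂ (passed (here refl) ℕₚ.≤-refl)

  Mitem-distinct-bases : ∀ gs j → proj₁ (key gs j) ≢ proj₁ (key gs (j ∸ 1)) →
                         Mitem gs j ≡ thr 1 (key gs j) (proj₁ (key gs (j ∸ 1)) , suc (proj₂ (key gs (j ∸ 1))))
  Mitem-distinct-bases gs j bases≢ =
    cong (if_then cst 0 else thr 1 (key gs j) (proj₁ (key gs (j ∸ 1)) , suc (proj₂ (key gs (j ∸ 1)))))
         (dec-false (proj₁ (key gs j) ℕ.≟ proj₁ (key gs (j ∸ 1))) bases≢)

  module Atom (α : Fin (length as)) where
    gs : List Group
    gs = groups (npeBar cf τ α)
    ℓ : ℕ
    ℓ = length gs

    coeff : ℕ → ℤ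
    coeff i = evalPoly e (polyAt gs i)

    coeff≤M : ∀ i → 1 ≤ i → i < ℓ → ℤ.∣ coeff i ∣ ≤ M
    coeff≤M i 1≤i i<ℓ = ∣evalPoly∣≤supBound σ (Pol cf τ) (polyAt gs i) (monoUnique (polyAt-∈ gs i 1≤i (ℕₚ.<⇒≤ i<ℓ)))
                                            (polyAt-⊆-Pol cf τ α i 1≤i i<ℓ)
      where
      monoUnique : (∃ λ g → g ∈ gs × polyAt gs i ≡ proj₂ g) → Unique (keys (polyAt gs i))
      monoUnique (g , g∈ , polyAt≡) = subst (Unique ∘ keys) (sym polyAt≡) (groups-monoUnique (npeBar cf τ α) g∈)

    open LeadingTerm ℓ (proj₁ ∘ key gs) (proj₂ ∘ key gs) coeff M
                     (key-increasing gs (groups-sorted (npeBar cf τ α))) coeff≤M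

    evalZ≡value : ∀ n → evalZ e n (npeBar cf τ α) ≡ value n
    evalZ≡value n = trans (evalZ≡sum-groups e n (npeBar cf τ α)) (sumBy-groupValue≡sumℤ e n gs)

    Citem∈ : ∀ {it} → it ∈ Citems gs → it ∈ allItems n₀ cf τ
    Citem∈ it∈ = there (∈-concatMap⁺ _ (Any.map (λ { refl → ∈-++⁺ˡ it∈ }) (∈-tabulate⁺ α)))

    Ditem∈ : ∀ {t it} → t ∈ tagged cf τ α → it ∈ Ditem t → it ∈ allItems n₀ cf τ
    Ditem∈ t∈ it∈ = there (∈-concatMap⁺ _
      (Any.map (λ { refl → ∈-++⁺ʳ (Citems gs) (∈-concatMap⁺ Ditem (Any.map (λ { refl → it∈ }) t∈)) }) (∈-tabulate⁺ α)))

    index-item∈ : ∀ j → 2 ≤ j → j ≤ ℓ → ∀ {it} → it ∈ Mitem gs j ∷ Nitems gs j → it ∈ Citems gs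
    index-item∈ j 2≤j j≤ℓ it∈ = there (∈-concatMap⁺ _ (Any.map (λ { refl → it∈ }) j∈))
      where
      j∈ : j ∈ map (ℕ._+ 2) (upTo (ℓ ∸ 1))
      j∈ = subst (_∈ map (ℕ._+ 2) (upTo (ℓ ∸ 1))) (ℕₚ.m∸n+n≡m 2≤j)
             (∈-map⁺ (ℕ._+ 2) (∈-upTo⁺ (m∸2<n∸1 2≤j j≤ℓ)))

    thresholds-from-B : ∀ {n} → B ≤ n → Thresholds n
    thresholds-from-B {n} B≤n = record
      { 1≤n = proj₂ (passed′ (here refl))
      ; 2M≤n = ℕₚ.≤-trans (ℕₚ.≤-trans (ℕₚ.≤-reflexive (cong (M ℕ.+_) (sym (ℕₚ.+-identityʳ M)))) (ℕₚ.m≤m+n (2 ℕ.* M) K)) B≤n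
      ; M-threshold = M-threshold
      ; N-threshold₁ = N-threshold₁
      ; N-threshold₂ = N-threshold₂
      }
      where
      passed′ : ∀ {it} → it ∈ Citems gs → ItemOK mt it × itemVal mt it ≤ n
      passed′ it∈ = passed (Citem∈ it∈) B≤n
      dominates : ∀ {k p p′} → ItemOK mt (thr k p p′) × itemVal mt (thr k p p′) ≤ n → k ℕ.* expN (proj₂ p′) (proj₁ p′) n < expN (proj₂ p) (proj₁ p) n
      dominates ((monoFrom , _) , passed-n) = monoFrom _ passed-n
      M-threshold : ∀ j → 2 ≤ j → j ≤ ℓ → proj₁ (key gs j) ≢ proj₁ (key gs (j ∸ 1)) → n ℕ.* term n (j ∸ 1) < term n j
      M-threshold j 2≤j j≤ℓ bases≢ =
        subst (_< term n j) (trans (ℕₚ.*-identityˡ _) (expN-suc (proj₂ (key gs (j ∸ 1))) (proj₁ (key gs (j ∸ 1))) n))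
          (dominates (subst (λ it → ItemOK mt it × itemVal mt it ≤ n) (Mitem-distinct-bases gs j bases≢)
                            (passed′ (index-item∈ j 2≤j j≤ℓ (here refl)))))
      N-threshold₁ : ∀ j → 3 ≤ j → j ≤ ℓ → (j ∸ 2) ℕ.* term n (j ∸ 2) < term n (j ∸ 1)
      N-threshold₁ 1 (s≤s ()) _
      N-threshold₁ 2 (s≤s (s≤s ())) _
      N-threshold₁ (suc (suc (suc j))) _ j≤ℓ = dominates (passed′ (index-item∈ (3 ℕ.+ j) (s≤s (s≤s z≤n)) j≤ℓ (there (here refl))))
      N-threshold₂ : ∀ j i → 3 ≤ j → j ≤ ℓ → 1 ≤ i → i ≤ j ∸ 3 → term n i < term n (j ∸ 2)
      N-threshold₂ 1 _ (s≤s ()) _ _ _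
      N-threshold₂ 2 _ (s≤s (s≤s ())) _ _ _
      N-threshold₂ (suc (suc (suc j))) zero _ _ () _
      N-threshold₂ (suc (suc (suc j))) (suc i) _ j≤ℓ _ i≤j =
        subst (_< term n (suc j)) (ℕₚ.*-identityˡ _)
          (dominates (passed′ (index-item∈ (3 ℕ.+ j) (s≤s (s≤s z≤n)) j≤ℓ
            (there (there (∈-map⁺ (λ i → thr 1 (key gs (suc j)) (key gs i)) (∈-map⁺ suc (∈-upTo⁺ i≤j))))))))

    evalZ-npeBar-pos-from-B : ∀ {n} → B ≤ n → 0ℤ ℤ.< evalZ e B (npeBar cf τ α) → 0ℤ ℤ.< evalZ e n (npeBar cf τ α)
    evalZ-npeBar-pos-from-B B≤n pos = subst (0ℤ ℤ.<_) (sym (evalZ≡value _))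
      (value-pos-stable (thresholds-from-B ℕₚ.≤-refl) (thresholds-from-B B≤n) (subst (0ℤ ℤ.<_) (evalZ≡value B) pos))

    atom-stable : ⟦ ψ' ⟧F σ → ∀ {s₁ s₂} → List.lookup as α ≡ (s₁ , s₂) → PolyOver S s₁ → PolyOver S s₂ →
                  AtomHolds (σ_ B) (s₁ , s₂) → ∀ {i} → B ≤ i → AtomHolds (σ_ i) (s₁ , s₂)
    atom-stable ψ'σ {s₁} {s₂} α≡ s₁∈ s₂∈ holds-B {i} B≤i = by-cases (any? (Tagged? ∘ proj₂) (tagged cf τ α))
      where
      atom⇔ : ∀ {n} → n₀ ≤ n → AtomHolds (σ_ n) (s₁ , s₂) ⇔ 0ℤ ℤ.< evalZ e n (npe (xs L) cf (s₁ , s₂))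
      atom⇔ n₀≤n = ClosedFormExpansion.atom⇔npe-pos L cf n₀ (proj₂ closed) σ n₀≤n s₁ s₂ s₁∈ s₂∈
      evalZ-Λ : ∀ n → evalZ e n (Λ cf α) ≡ evalZ e n (npe (xs L) cf (s₁ , s₂))
      evalZ-Λ n = cong (λ a → evalZ e n (npe (xs L) cf a)) α≡
      0<Λ-B : 0ℤ ℤ.< evalZ e B (Λ cf α)
      0<Λ-B = subst (0ℤ ℤ.<_) (sym (evalZ-Λ B)) (Equivalence.to (atom⇔ n₀≤B) holds-B)
      by-cases : Dec (Any (Tagged ∘ proj₂) (tagged cf τ α)) → AtomHolds (σ_ i) (s₁ , s₂)
      by-cases (no untagged) = Equivalence.from (atom⇔ (ℕₚ.≤-trans n₀≤B B≤i))
        (subst (0ℤ ℤ.<_) (trans (cong (evalZ e i) npeBar≡Λ) (evalZ-Λ i))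
          (evalZ-npeBar-pos-from-B B≤i (subst (0ℤ ℤ.<_) (cong (evalZ e B) (sym npeBar≡Λ)) 0<Λ-B)))
        where
        npeBar≡Λ : npeBar cf τ α ≡ Λ cf α
        npeBar≡Λ = replaced-untagged (Λ cf α) (τ α) untagged
      -- With Δ ∪ Γ nonempty the replaced sum dominates npe but is eventually non-positive,
      -- so the atom cannot hold at B in the first place.
      by-cases (yes someTagged) = from-eventually (eventuallyNonPos α someTagged e ψ'e)
        where
        ψ'e : ⟦ ψ' ⟧F (σ[ xs L ↦ e ])
        ψ'e = subst id (⟦⟧F-agree ψ' (ψ-over , φ-over) (σ[↦map]-agree (xs L) σ)) ψ'σ
        0<npeBar-B : 0ℤ ℤ.< evalZ e B (npeBar cf τ α)
        0<npeBar-B = ℤₚ.<-≤-trans 0<Λ-B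
          (evalZ-replaced-≥ mt ψ'σ B (Λ cf α) (τ α) (valid α) λ t∈ it∈ → passed (Ditem∈ t∈ it∈) ℕₚ.≤-refl)
        from-eventually : (∃ λ N → ∀ n → N ≤ n → evalZ e n (npeBar cf τ α) ℤ.≤ 0ℤ) → AtomHolds (σ_ i) (s₁ , s₂)
        from-eventually (N , nonPos) = ⊥-elim (ℤₚ.<⇒≱ (evalZ-npeBar-pos-from-B (ℕₚ.m≤n⊔m N B) 0<npeBar-B)
                                                      (nonPos (N ⊔ B) (ℕₚ.m≤m⊔n N B)))

  guard-stable : ⟦ ψ' ⟧F σ → ⟦ φ L ⟧F (σ_ B) → ∀ {i} → B ≤ i → ⟦ φ L ⟧F (σ_ i)
  guard-stable ψ'σ φ-B {i} B≤i = ⟦⟧F-mono (φ L) stable φ-B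
    where
    stable : ∀ {a} → a ∈ as → AtomHolds (σ_ B) a → AtomHolds (σ_ i) a
    stable a∈ holds = Atom.atom-stable (Any.index a∈) ψ'σ (sym (lookup-index a∈))
                                       (proj₁ (atoms-over (φ L) φ-over a∈)) (proj₂ (atoms-over (φ L) φ-over a∈)) holds B≤i

  terminating-run-bounded : ⟦ ψ L ⟧F σ → ¬ GuardAlways L σ → ∀ {m} → GuardedBelow L σ m → m ≤ B
  terminating-run-bounded ψσ terminates {m} φ<m = decidable-stable (m ℕ.≤? B) λ m≰B →
    let B<m = ℕₚ.≰⇒> m≰B in terminates λ i → case (i ℕ.<? m) B<m
    where
    case : ∀ {i} → Dec (i < m) → B < m → ⟦ φ L ⟧F (σ_ i)
    case {i} (yes i<m) _ = φ<m i i<m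
    case {i} (no i≮m) B<m =
      guard-stable (ψσ , φ<m 0 (ℕₚ.≤-<-trans z≤n B<m)) (φ<m B B<m) (ℕₚ.≤-trans (ℕₚ.<⇒≤ B<m) (ℕₚ.≮⇒≥ i≮m))

stabilizationBound-bounds-run : ∀ {d} (L : Loop d) {q} → IsStabBound L q →
  FormulaOver (toList (xs L)) (φ L) → FormulaOver (toList (xs L)) (ψ L) →
  ∀ σ → ⟦ ψ L ⟧F σ → ¬ GuardAlways L σ → ∀ m → GuardedBelow L σ m → fin m ≤∞ evalB ∣ σ ∣ₛ q
stabilizationBound-bounds-run L (n₀ , cf , closed , τ , valid , eventuallyNonPos , mt , thresholds , refl)
                              φ-over ψ-over σ ψσ terminates m φ<m =
  subst (fin m ≤∞_) (sym evalB-sth) (fin≤ (terminating-run-bounded ψσ terminates φ<m))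
  where open Stabilization L n₀ cf closed τ valid eventuallyNonPos mt thresholds φ-over ψ-over σ

≤∞-dec : ∀ k x → Dec (fin k ≤∞ x)
≤∞-dec k ∞ = yes (_ ≤ω)
≤∞-dec k (fin n) with k ℕ.≤? n
... | yes k≤n = yes (fin≤ k≤n)
... | no k≰n = no λ { (fin≤ k≤n) → k≰n k≤n }

≤∞-trans-≤ : ∀ {k m x} → k ≤ m → fin m ≤∞ x → fin k ≤∞ x
≤∞-trans-≤ k≤m (fin≤ m≤n) = fin≤ (ℕₚ.≤-trans k≤m m≤n)
≤∞-trans-≤ k≤m (_ ≤ω) = _ ≤ω

terminating⇒guard-fails : ∀ {d} (L : Loop d) → Terminating (loopProgram L) → ∀ σ → ⟦ ψ L ⟧F σ → ¬ GuardAlways L σ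
terminating⇒guard-fails L terminating σ ψσ φ-always = terminating (run , refl , steps)
  where
  S : List Var
  S = toList (xs L)
  run : ℕ → Config
  run zero = 0 , σ
  run (suc n) = 1 , updateⁿ S (η L) n σ
  steps : ∀ k → StepAll (loopProgram L) (run k) (run (suc k))
  steps zero = Fin.zero , tt , refl , refl , ψσ , λ v _ → refl
  steps (suc n) = Fin.suc Fin.zero , tt , refl , refl , φ-always n ,
    λ v v∈ → trans (updateⁿ-suc S (η L) n σ v) (update-∈ S (η L) (updateⁿ S (η L) n σ) v∈)

double : ℕ → ℕ
double zero = zero
double (suc i) = suc (suc (double i))

half : ℕ → ℕ
half zero = zero
half (suc zero) = zero
half (suc (suc n)) = suc (half n)

≤1+double-half : ∀ m → m ≤ suc (double (half m))
≤1+double-half zero = z≤n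
≤1+double-half (suc zero) = s≤s z≤n
≤1+double-half (suc (suc m)) = s≤s (s≤s (≤1+double-half m))

<half⇒1+double< : ∀ m i → i < half m → suc (double i) < m
<half⇒1+double< (suc (suc m)) zero _ = s≤s (s≤s z≤n)
<half⇒1+double< (suc (suc m)) (suc i) (s≤s i<half) = s≤s (s≤s (<half⇒1+double< m i i<half))

even-or-odd : ∀ j → ∃ λ i → j ≡ double i ⊎ j ≡ suc (double i)
even-or-odd zero = zero , inj₁ refl
even-or-odd (suc zero) = zero , inj₂ refl
even-or-odd (suc (suc j)) with i , parity ← even-or-odd j with parity
... | inj₁ refl = suc i , inj₁ refl
... | inj₂ refl = suc i , inj₂ refl

double≤+ : ∀ {a b} → a ≤ b → double a ≤ b ℕ.+ b
double≤+ {zero} _ = z≤n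
double≤+ {suc a} {suc b} (s≤s a≤b) = s≤s (ℕₚ.≤-trans (s≤s (double≤+ a≤b)) (ℕₚ.≤-reflexive (sym (ℕₚ.+-suc b b))))

≤half⇒≤2*+1 : ∀ {k m x} → k ≤ m → fin (half m) ≤∞ x → fin k ≤∞ ((fin 2 *∞ x) +∞ fin 1)
≤half⇒≤2*+1 {k} {m} {fin b} k≤m (fin≤ half≤b) = fin≤ (begin
  k                       ≤⟨ k≤m ⟩
  m                       ≤⟨ ≤1+double-half m ⟩
  suc (double (half m))   ≤⟨ s≤s (double≤+ half≤b) ⟩
  suc (b ℕ.+ b)           ≡⟨ cong suc (cong (b ℕ.+_) (sym (ℕₚ.+-identityʳ b))) ⟩
  suc (b ℕ.+ (b ℕ.+ 0))   ≡⟨ ℕₚ.+-comm 1 _ ⟩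
  2 ℕ.* b ℕ.+ 1           ∎)
  where open ℕₚ.≤-Reasoning
≤half⇒≤2*+1 {x = ∞} _ (_ ≤ω) = _ ≤ω

module SquaredLoop {d : ℕ} (L : Loop d) where
  private
    S : List Var
    S = toList (xs L)
    η² : Var → Poly
    η² = η (L ⋆ L)

  update-η² : ∀ σ → update S η² σ ≗ update S (η L) (update S (η L) σ)
  update-η² σ v with does (v ∈? S) | ⟦substP⟧ S (η L) (η L v) σ
  ... | true | η²-value = η²-value
  ... | false | _ = refl

  updateⁿ-η² : ∀ i σ → updateⁿ S η² i σ ≗ updateⁿ S (η L) (double i) σ
  updateⁿ-η² zero σ v = refl
  updateⁿ-η² (suc i) σ v = trans (updateⁿ-cong S η² i (update-η² σ) v) (updateⁿ-η² i _ v)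

  guard-η²⇒ : ∀ σ i → ⟦ φ (L ⋆ L) ⟧F (updateⁿ S η² i σ) →
              ⟦ φ L ⟧F (updateⁿ S (η L) (double i) σ) × ⟦ φ L ⟧F (updateⁿ S (η L) (suc (double i)) σ)
  guard-η²⇒ σ i (φ-even , φ-odd) =
    subst id (⟦⟧F-cong (φ L) (updateⁿ-η² i σ)) φ-even ,
    subst id (⟦⟧F-cong (φ L) odd≗) (subst id (⟦substF⟧ S (η L) (φ L) _) φ-odd)
    where
    odd≗ : update S (η L) (updateⁿ S η² i σ) ≗ updateⁿ S (η L) (suc (double i)) σ
    odd≗ v = trans (update-cong S (η L) (updateⁿ-η² i σ) v) (sym (updateⁿ-suc S (η L) (double i) σ v))

  ⇒guard-η² : ∀ σ i → ⟦ φ L ⟧F (updateⁿ S (η L) (double i) σ) → ⟦ φ L ⟧F (updateⁿ S (η L) (suc (double i)) σ) →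
              ⟦ φ (L ⋆ L) ⟧F (updateⁿ S η² i σ)
  ⇒guard-η² σ i φ-even φ-odd =
    subst id (⟦⟧F-cong (φ L) (λ v → sym (updateⁿ-η² i σ v))) φ-even ,
    subst id (sym (⟦substF⟧ S (η L) (φ L) _)) (subst id (⟦⟧F-cong (φ L) odd≗) φ-odd)
    where
    odd≗ : updateⁿ S (η L) (suc (double i)) σ ≗ update S (η L) (updateⁿ S η² i σ)
    odd≗ v = trans (updateⁿ-suc S (η L) (double i) σ v) (sym (update-cong S (η L) (updateⁿ-η² i σ) v))

  guard-always-η²⇒ : ∀ σ → GuardAlways (L ⋆ L) σ → GuardAlways L σ
  guard-always-η²⇒ σ φ²-always j with i , parity ← even-or-odd j with parity
  ... | inj₁ refl = proj₁ (guard-η²⇒ σ i (φ²-always i))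
  ... | inj₂ refl = proj₂ (guard-η²⇒ σ i (φ²-always i))

  guard-upTo-η² : ∀ σ m → GuardedBelow L σ m → GuardedBelow (L ⋆ L) σ (half m)
  guard-upTo-η² σ m φ<m i i<half =
    ⇒guard-η² σ i (φ<m (double i) (ℕₚ.≤-trans (ℕₚ.n≤1+n _) odd<m)) (φ<m (suc (double i)) odd<m)
    where odd<m = <half⇒1+double< m i i<half

module TransitionRuns (P : Program) {S : List Var} (S⊆PV : All (_∈ PV P) S) (t : Fin (nT P))
  (guard-over : FormulaOver S (guard (T P t))) (upd-over : ∀ {v} → v ∈ S → PolyOver S (upd (T P t) v))
  (σ : State) where

  private
    η′ : Var → Poly
    η′ = upd (T P t)

  GuardHolds : ℕ → Set
  GuardHolds i = ⟦ guard (T P t) ⟧F (updateⁿ S η′ i σ)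

  GuardedUpTo : ℕ → Set
  GuardedUpTo i = ∀ j → j < i → GuardHolds j

  guardedUpTo-suc : ∀ {i} → GuardedUpTo i → GuardHolds i → GuardedUpTo (suc i)
  guardedUpTo-suc {i} guarded holds j j<1+i with ℕₚ.m≤n⇒m<n∨m≡n (ℕₚ.≤-pred j<1+i)
  ... | inj₁ j<i = guarded j j<i
  ... | inj₂ refl = holds

  step-tracks : ∀ {i c c′} → AgreeOn S (proj₂ c) (updateⁿ S η′ i σ) → Step P (T P t) c c′ →
                GuardHolds i × AgreeOn S (proj₂ c′) (updateⁿ S η′ (suc i) σ)
  step-tracks {i} agree (_ , _ , guard-c , update-c) =
    subst id (⟦⟧F-agree (guard (T P t)) guard-over agree) guard-c ,
    λ {v} v∈ → trans (update-c v (All.lookup S⊆PV v∈))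
      (trans (⟦⟧-agree (η′ v) (upd-over v∈) agree)
        (trans (sym (update-∈ S η′ (updateⁿ S η′ i σ) v∈)) (sym (updateⁿ-suc S η′ i σ v))))

  steps-track : ∀ {i c c′} → GuardedUpTo i → AgreeOn S (proj₂ c) (updateⁿ S η′ i σ) → Star (StepIn P (_≡ t)) c c′ →
                ∃ λ i′ → i ≤ i′ × GuardedUpTo i′ × AgreeOn S (proj₂ c′) (updateⁿ S η′ i′ σ)
  steps-track {i} guarded agree ε = i , ℕₚ.≤-refl , guarded , agree
  steps-track {i} guarded agree ((_ , refl , step) ◅ rest)
    with holds , agree′ ← step-tracks {i} agree step
    with i′ , i<i′ , guarded′ , agree″ ← steps-track (guardedUpTo-suc guarded holds) agree′ rest =
    i′ , ℕₚ.≤-trans (ℕₚ.n≤1+n i) i<i′ , guarded′ , agree″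

  iterations-track : ∀ k {i c c′} → GuardedUpTo i → AgreeOn S (proj₂ c) (updateⁿ S η′ i σ) →
                     Pow k (Star (StepIn P (_≡ t)) ⨾ Step P (T P t)) c c′ → ∃ λ i′ → k ℕ.+ i ≤ i′ × GuardedUpTo i′
  iterations-track zero {i} guarded _ _ = i , ℕₚ.≤-refl , guarded
  iterations-track (suc k) {i} guarded agree (_ , (_ , steps , step) , rest)
    with i₁ , i≤i₁ , guarded₁ , agree₁ ← steps-track guarded agree steps
    with holds , agree₂ ← step-tracks {i₁} agree₁ step
    with i′ , k+1+i₁≤i′ , guarded′ ← iterations-track k (guardedUpTo-suc guarded₁ holds) agree₂ rest =
    i′ , ℕₚ.≤-trans (ℕₚ.≤-trans (ℕₚ.≤-reflexive (sym (ℕₚ.+-suc k i))) (ℕₚ.+-monoʳ-≤ k (s≤s i≤i₁))) k+1+i₁≤i′ , guarded′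

  iterations-guarded : ∀ k {ℓ c′} → Pow k (Star (StepIn P (_≡ t)) ⨾ Step P (T P t)) (ℓ , σ) c′ →
                       ∃ λ m → k ≤ m × GuardedUpTo m
  iterations-guarded k run with m , k+0≤m , guarded ← iterations-track k (λ _ ()) (λ _ → refl) run =
    m , ℕₚ.≤-trans (ℕₚ.≤-reflexive (sym (ℕₚ.+-identityʳ k))) k+0≤m , guarded

-- Deciding the goal stands in for excluded middle on the three cases defining RB_loc.
by-loop-kind : {Goal Tnn Twn Term : Set} → Dec Goal → (Tnn × Term → Goal) → (Twn × ¬ Tnn × Term → Goal) →
               (¬ (Twn × Term) → Goal) → Goal
by-loop-kind goal? tnn-case twn-case other-case = decidable-stable goal? λ ¬goal →
  ¬goal (other-case λ (twn , term) → ¬goal (twn-case (twn , (λ tnn → ¬goal (tnn-case (tnn , term))) , term)))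

tnn-iterations-bounded : ∀ {d} (L : Loop d) {q} → IsStabBound L q → Terminating (loopProgram L) →
  FormulaOver (toList (xs L)) (φ L) → FormulaOver (toList (xs L)) (ψ L) → ∀ σ → ⟦ ψ L ⟧F σ →
  ∀ {k m} → k ≤ m → GuardedBelow L σ m → fin k ≤∞ evalB ∣ σ ∣ₛ q
tnn-iterations-bounded L q-bound term φ-over ψ-over σ ψσ {m = m} k≤m guarded =
  ≤∞-trans-≤ k≤m (stabilizationBound-bounds-run L q-bound φ-over ψ-over σ ψσ (terminating⇒guard-fails L term σ ψσ) m guarded)

-- L ⋆ L runs half as long as L, with the same invariant ψ.
twn-iterations-bounded : ∀ {d} (L : Loop d) {q} → IsStabBound (L ⋆ L) q → Terminating (loopProgram L) →
  FormulaOver (toList (xs L)) (φ L) → (∀ {v} → v ∈ toList (xs L) → PolyOver (toList (xs L)) (η L v)) →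
  FormulaOver (toList (xs L)) (ψ L) → ∀ σ → ⟦ ψ L ⟧F σ →
  ∀ {k m} → k ≤ m → GuardedBelow L σ m → fin k ≤∞ evalB ∣ σ ∣ₛ ((nat 2 ⊠ q) ⊞ nat 1)
twn-iterations-bounded L q-bound term φ-over η-over ψ-over σ ψσ {m = m} k≤m guarded =
  ≤half⇒≤2*+1 k≤m (stabilizationBound-bounds-run (L ⋆ L) q-bound (φ-over , substF-over (η L) (φ L) η-over φ-over) ψ-over
    σ ψσ (terminating⇒guard-fails L term σ ψσ ∘ guard-always-η²⇒ σ) (half m) (guard-upTo-η² σ m guarded))
  where open SquaredLoop L using (guard-always-η²⇒; guard-upTo-η²)

RBlocChoice : ∀ {d} → Loop d → Bound → Set
RBlocChoice L rb =
  ((IsTnnLoop L × Terminating (loopProgram L)) → IsStabBound L rb) ×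
  ((IsTwnLoop L × ¬ IsTnnLoop L × Terminating (loopProgram L)) →
     Σ Bound (λ q → IsStabBound (L ⋆ L) q × rb ≡ (nat 2 ⊠ q) ⊞ nat 1)) ×
  (¬ (IsTwnLoop L × Terminating (loopProgram L)) → rb ≡ ω)

guarded-iterations-bounded : ∀ {d} (L : Loop d) {rb} → RBlocChoice L rb →
  FormulaOver (toList (xs L)) (φ L) → (∀ {v} → v ∈ toList (xs L) → PolyOver (toList (xs L)) (η L v)) →
  FormulaOver (toList (xs L)) (ψ L) → ∀ σ → ⟦ ψ L ⟧F σ →
  ∀ {k m} → k ≤ m → GuardedBelow L σ m → fin k ≤∞ evalB ∣ σ ∣ₛ rb
guarded-iterations-bounded L {rb} (tnn-bound , twn-bound , other-bound) φ-over η-over ψ-over σ ψσ {k} k≤m guarded =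
  by-loop-kind (≤∞-dec k (evalB ∣ σ ∣ₛ rb))
    (λ (tnn , term) → tnn-iterations-bounded L (tnn-bound (tnn , term)) term φ-over ψ-over σ ψσ k≤m guarded)
    (λ (twn , ¬tnn , term) → let q , q-bound , rb≡ = twn-bound (twn , ¬tnn , term) in
       subst (λ b → fin k ≤∞ evalB ∣ σ ∣ₛ b) (sym rb≡)
             (twn-iterations-bounded L q-bound term φ-over η-over ψ-over σ ψσ k≤m guarded))
    (λ other → subst (λ b → fin k ≤∞ evalB ∣ σ ∣ₛ b) (sym (other-bound other)) (_ ≤ω))

theorem29 :
  (P : Program) → WellFormed P →
  (d : ℕ) (xs : Vec Var d) → Unique (toList xs) → All (_∈ PV P) (toList xs) →
  (t : Fin (nT P)) → src (T P t) ≡ tgt (T P t) →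
  FormulaOver (toList xs) (guard (T P t)) →
  (∀ v → v ∈ toList xs → PolyOver (toList xs) (upd (T P t) v)) →
  (∀ v → v ∈ PV P → v ∉ toList xs → ∀ σ → ⟦ upd (T P t) v ⟧ σ ≡ σ v) →
  (ψr : Fin (nT P) → Formula) →
  (∀ r → Entry P (_≡ t) r →
     FormulaOver (toList xs) (ψr r) ×
     (∀ σ → ⟦ ψr r ⟧F σ → ⟦ substF (PV P) (upd (T P t)) (ψr r) ⟧F σ) ×
     (∀ σ₀ c σ → Star (StepAll P) (ℓ₀ P , σ₀) c →
        Step P (T P r) c (src (T P t) , σ) → ⟦ ψr r ⟧F σ)) →
  (RB : Fin (nT P) → Bound) →
  (∀ r → Entry P (_≡ t) r →
     let Lr = loop xs (ψr r) (guard (T P t)) (upd (T P t)) in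
     ((IsTnnLoop Lr × Terminating (loopProgram Lr)) → IsStabBound Lr (RB r)) ×
     ((IsTwnLoop Lr × ¬ IsTnnLoop Lr × Terminating (loopProgram Lr)) →
        Σ Bound (λ q → IsStabBound (Lr ⋆ Lr) q × RB r ≡ (nat 2 ⊠ q) ⊞ nat 1)) ×
     (¬ (IsTwnLoop Lr × Terminating (loopProgram Lr)) → RB r ≡ ω)) →
  LocalRuntimeBound P (_≡ t) (_≡ t) RB
-- Only the variables xs are observed along a run of t.
theorem29 P _ d xs _ xs⊆PV t _ guard-over upd-over _ ψr hψ RB hRB .t refl r entry@(_ , _ , refl , tgt≡src)
          σ₀ c ℓ″ σ k c′ reach step-r run =
  let m , k≤m , guarded = iterations-guarded k run in
  guarded-iterations-bounded Lᵣ (hRB r entry) guard-over (λ {v} → upd-over v) (proj₁ (hψ r entry)) σ ψσ k≤m guarded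
  where
  Lᵣ : Loop d
  Lᵣ = loop xs (ψr r) (guard (T P t)) (upd (T P t))
  open TransitionRuns P xs⊆PV t guard-over (λ {v} → upd-over v) σ using (iterations-guarded)
  ψσ : ⟦ ψr r ⟧F σ
  ψσ = proj₂ (proj₂ (hψ r entry)) σ₀ c σ reach
         (subst (λ ℓ → Step P (T P r) c (ℓ , σ)) (trans (proj₁ (proj₂ step-r)) tgt≡src) step-r)
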